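{- Let $d$ be a positive integer and $\mathcal D$ a Ferrers diagram of order $n$ with $\mathcal D\cap\mathcal B_{n,d-1}\neq\emptyset$. Then the following are equivalent: (1) $(\mathcal D,d)$ is irreducible. (2) $(\mathcal D,d)$ is in $(a,b)$-standard form for some integers $a,b\ge d-1$, and: $\nu_0(\mathcal D,d)=\nu_{d-1}(\mathcal D,d)$; $\nu_j(\mathcal D,d)\ge\nu_0(\mathcal D,d)$ for all $j\in[d-2]$; and, only in the case $a=b=d-1$, there exists $j\in[d-2]$ with $\nu_j(\mathcal D,d)=\nu_0(\mathcal D,d)$. (3) $(\mathcal D,d)$ is in $(a,b)$-standard form for some integers $a,b\ge d-1$, and with $X=X(\mathcal D,d)$, $Y=Y(\mathcal D,d)$: $|Y|-|X|=(b-a)(d-1)$; for all $j\in[d-2]$, $$j(b-a+d-1-j)+\sum_{i=1}^{j}c_{d-i}(X)-\sum_{i=1}^{j}c_i(Y)\ge 0;$$ and, only in the case $a=b=d-1$, there exists $j\in[d-2]$ for which equality holds in the last inequality.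
   Context: $\mathbb N=\{1,2,\dots\}$, $[n]=\{1,\dots,n\}$. A Ferrers diagram is a finite set $\mathcal D\subseteq\mathbb N^2$ such that $(x,y)\in\mathcal D$ implies $(i,j)\in\mathcal D$ for all $i\in[x]$, $j\in[y]$ (first coordinate = row, second = column); it has order $n$ if $\mathcal D\subseteq[n]^2$. For $0\le j\le d-1$, $\nu_j(\mathcal D,d)=|\{(x,y)\in\mathcal D: x\ge d-j,\ y\ge j+1\}|$, and $\nu_{\min}(\mathcal D,d)=\min_j\nu_j(\mathcal D,d)$. A point $P\in\mathcal D$ is removable if $\mathcal D\setminus\{P\}$ is a Ferrers diagram. For removable $P$ and $\mathcal D'=\mathcal D\setminus\{P\}$: if $\nu_{\min}(\mathcal D',d)=\nu_{\min}(\mathcal D,d)$ write $\mathcal D'\xrightarrow{d}\mathcal D$, otherwise $\mathcal D\xrightarrow{d}\mathcal D'$. $(\mathcal D,d)$ is reducible if some Ferrers diagram $\mathcal D'$ satisfies $\mathcal D'\xrightarrow{d}\mathcal D$, irreducible otherwise. Let $\mathcal B_{n,d-1}=\{d-1,\dots,n\}\times\{d-1,\dots,n\}$. $(\mathcal D,d)$ with $\mathcal D$ of order $n$ is in $(a,b)$-standard form ($a,b\ge d-1$ integers) if $\mathcal D\cap\mathcal B_{n,d-1}=\{d-1,\dots,a\}\times\{d-1,\dots,b\}$. Then $X(\mathcal D,d)=\{(y,x):(x,y)\in\mathcal D,\ x\in[d-2],\ y\ge b+1\}$ and $Y(\mathcal D,d)=\{(x,y)\in\mathcal D: x\ge a+1,\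 y\in[d-2]\}$. For a finite set $Z\subseteq\mathbb N^2$ and $i\in\mathbb N$, $c_i(Z)=|Z\cap(\mathbb N\times\{i\})|$. -}

module Defs where

open import Data.Nat using (ℕ; zero; suc; _+_; _*_; _∸_; _≤_; _⊓_; _≤ᵇ_; _≡ᵇ_)
open import Data.Bool using (Bool; true; false; _∧_; not; if_then_else_)
open import Data.Product using (Σ; _×_; _,_)
open import Data.Sum using (_⊎_)
open import Data.Integer as ℤ using (ℤ; +_)
open import Relation.Nullary using (¬_)
open import Relation.Binary.PropositionalEquality using (_≡_; _≢_)
open import Function.Bundles using (_⇔_)

-- Points of ℕ² are pairs of Agda naturals; the paper's ℕ = {1,2,…} is
-- enforced by the boundedness field (every point of a diagram of order n
-- lies in [n]² = {1..n}²).

record FerrersDiagram (n : ℕ) : Set where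
  field
    mem        : ℕ → ℕ → Bool
    bounded    : ∀ x y → mem x y ≡ true → (1 ≤ x × x ≤ n) × (1 ≤ y × y ≤ n)
    downClosed : ∀ x y i j → mem x y ≡ true →
                 1 ≤ i → i ≤ x → 1 ≤ j → j ≤ y → mem i j ≡ true
open FerrersDiagram public

sumTo : ℕ → (ℕ → ℕ) → ℕ
sumTo zero    f = 0
sumTo (suc j) f = sumTo j f + f (suc j)

sumToℤ : ℕ → (ℕ → ℤ) → ℤ
sumToℤ zero    f = + 0
sumToℤ (suc j) f = sumToℤ j f ℤ.+ f (suc j)

count : ℕ → (ℕ → Bool) → ℕ
count N f = sumTo N (λ k → if f k then 1 else 0)

card2 : ℕ → (ℕ → ℕ → Bool) → ℕ
card2 N p = sumTo N (λ x → count N (p x))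

ν : ∀ {n} → FerrersDiagram n → ℕ → ℕ → ℕ
ν {n} D d j = card2 n (λ x y → mem D x y ∧ ((d ∸ j) ≤ᵇ x) ∧ (suc j ≤ᵇ y))

minTo : (ℕ → ℕ) → ℕ → ℕ
minTo f zero    = f 0
minTo f (suc k) = minTo f k ⊓ f (suc k)

νmin : ∀ {n} → FerrersDiagram n → ℕ → ℕ
νmin D d = minTo (ν D d) (d ∸ 1)

-- D' = D ∖ {(p , q)} with (p , q) ∈ D.  (Since D' is itself a Ferrers
-- diagram, (p , q) is then a removable point of D.)
IsPointRemoval : ∀ {m n} → FerrersDiagram m → FerrersDiagram n → ℕ → ℕ → Set
IsPointRemoval D' D p q =
  (mem D p q ≡ true) ×
  (∀ x y → mem D' x y ≡ (mem D x y ∧ not ((x ≡ᵇ p) ∧ (y ≡ᵇ q))))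

Arrow : ∀ {m n} → FerrersDiagram m → ℕ → FerrersDiagram n → Set
Arrow D₁ d D₂ =
  (Σ ℕ λ p → Σ ℕ λ q → IsPointRemoval D₁ D₂ p q × (νmin D₁ d ≡ νmin D₂ d))
  ⊎ (Σ ℕ λ p → Σ ℕ λ q → IsPointRemoval D₂ D₁ p q × (νmin D₂ d ≢ νmin D₁ d))

Reducible : ∀ {n} → FerrersDiagram n → ℕ → Set
Reducible D d = Σ ℕ λ m → Σ (FerrersDiagram m) λ D' → Arrow D' d D

Irreducible : ∀ {n} → FerrersDiagram n → ℕ → Set
Irreducible D d = ¬ Reducible D d

MeetsB : ∀ {n} → FerrersDiagram n → ℕ → Set
MeetsB {n} D d = Σ ℕ λ x → Σ ℕ λ y →
  (d ∸ 1 ≤ x × x ≤ n) × (d ∸ 1 ≤ y × y ≤ n) × (mem D x y ≡ true)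

StandardForm : ∀ {n} → FerrersDiagram n → ℕ → ℕ → ℕ → Set
StandardForm {n} D d a b = ∀ x y →
  (((d ∸ 1 ≤ x × x ≤ n) × (d ∸ 1 ≤ y × y ≤ n)) × mem D x y ≡ true)
  ⇔ ((d ∸ 1 ≤ x × x ≤ a) × (d ∸ 1 ≤ y × y ≤ b))

Xmem : ∀ {n} → FerrersDiagram n → ℕ → ℕ → ℕ → ℕ → Bool
Xmem D d b p q = mem D q p ∧ (1 ≤ᵇ q) ∧ (q ≤ᵇ (d ∸ 2)) ∧ (suc b ≤ᵇ p)

Ymem : ∀ {n} → FerrersDiagram n → ℕ → ℕ → ℕ → ℕ → Bool
Ymem D d a x y = mem D x y ∧ (suc a ≤ᵇ x) ∧ (1 ≤ᵇ y) ∧ (y ≤ᵇ (d ∸ 2))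

c : ℕ → (ℕ → ℕ → Bool) → ℕ → ℕ
c N Z i = count N (λ p → Z p i)

Cond2 : ∀ {n} → FerrersDiagram n → ℕ → Set
Cond2 D d = Σ ℕ λ a → Σ ℕ λ b →
  (d ∸ 1 ≤ a) × (d ∸ 1 ≤ b) × StandardForm D d a b ×
  (ν D d 0 ≡ ν D d (d ∸ 1)) ×
  (∀ j → 1 ≤ j → j ≤ d ∸ 2 → ν D d 0 ≤ ν D d j) ×
  (a ≡ d ∸ 1 → b ≡ d ∸ 1 →
     Σ ℕ λ j → (1 ≤ j × j ≤ d ∸ 2) × (ν D d j ≡ ν D d 0))

Φ : ∀ {n} → FerrersDiagram n → ℕ → ℕ → ℕ → ℕ → ℤ
Φ {n} D d a b j =
  ((+ j) ℤ.* ((+ b) ℤ.- (+ a) ℤ.+ (+ (d ∸ 1)) ℤ.- (+ j)))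
  ℤ.+ sumToℤ j (λ i → + c n (Xmem D d b) (d ∸ i))
  ℤ.- sumToℤ j (λ i → + c n (Ymem D d a) i)

Cond3 : ∀ {n} → FerrersDiagram n → ℕ → Set
Cond3 {n} D d = Σ ℕ λ a → Σ ℕ λ b →
  (d ∸ 1 ≤ a) × (d ∸ 1 ≤ b) × StandardForm D d a b ×
  ((+ card2 n (Ymem D d a)) ℤ.- (+ card2 n (Xmem D d b))
     ≡ ((+ b) ℤ.- (+ a)) ℤ.* (+ (d ∸ 1))) ×
  (∀ j → 1 ≤ j → j ≤ d ∸ 2 → + 0 ℤ.≤ Φ D d a b j) ×
  (a ≡ d ∸ 1 → b ≡ d ∸ 1 →
     Σ ℕ λ j → (1 ≤ j × j ≤ d ∸ 2) × (Φ D d a b j ≡ + 0))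

-- Removing or adding a cell P changes ν_j by one exactly when P lies in the quadrant
-- Q_j = {x ≥ d-j, y ≥ j+1}. So removing P keeps ν_min iff P avoids every minimising quadrant,
-- adding P changes ν_min iff P lies in every minimising quadrant, and (D,d) is irreducible iff
-- no cell allows either move.
--
-- (2) ⇒ (1): 0 and d-1 are minimisers. A removable cell outside Q_0 ∪ Q_{d-1} lies in [d-1]², so it
-- is the corner (d-1,d-1) and a = b = d-1, where the extra minimiser catches it; an addable cell in
-- Q_0 ∩ Q_{d-1} lies in B, hence in the rectangle D ∩ B.
--
-- (1) ⇒ (2): an addable cell of B would be a move, so D ∩ B is a rectangle. If the first minimiser
-- j were positive, row 1 could be extended (j = d-1); otherwise, with r = d-1-j, a cell of row r
-- overhanging row r+1 allows an addition, a cell of column j overhanging column j+1 a removal, and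
-- if neither exists, counting Q_{j-1}, Q_j, Q_{j+1} along these rows and columns shows that ν is
-- concave at j, forcing ν_{j-1} = ν_j. Symmetrically for the last minimiser. When a = b = d-1 the
-- corner (d-1,d-1) is removable unless some 0 < j < d-1 is a minimiser.
--
-- (2) ⇔ (3): in standard form the same counting gives ν_{j+1} - ν_j = Φ_{j+1} - Φ_j, so
-- Φ_j = ν_j - ν_0, and Φ_{d-1} = (d-1)(b-a) + |X| - |Y|.

module Submission where

open import Defs
open import Data.Bool using (Bool; true; false; _∧_; _∨_; not; if_then_else_)
import Data.Bool as Bool
open import Data.Bool.Properties
  using (∧-zeroʳ; ∧-identityʳ; ∧-comm; ∨-identityʳ; ∨-zeroʳ; T-≡; ¬-not)
open import Data.Empty using (⊥; ⊥-elim)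
open import Data.Integer as ℤ using (ℤ; +_; +≤+)
import Data.Integer.Properties as ℤP
open import Data.Integer.Tactic.RingSolver using (solve-∀)
open import Data.Nat
  using (ℕ; zero; suc; _+_; _∸_; _≤_; _<_; _≤′_; ≤′-refl; ≤′-step; _≤ᵇ_; _≡ᵇ_; z≤n; s≤s; s≤s⁻¹)
open import Data.Nat.Properties
open import Algebra.Properties.CommutativeSemigroup +-commutativeSemigroup using (interchange; xy∙z≈xz∙y)
open import Data.Product using (Σ; ∃-syntax; _×_; _,_; proj₁; proj₂; swap)
open import Data.Sum using (_⊎_; inj₁; inj₂)
open import Function.Bundles using (_⇔_; mk⇔; Equivalence)
open import Function.Properties.Equivalence using () renaming (trans to ⇔-trans)
open import Relation.Binary.Definitions using (tri<; tri≈; tri>)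
open import Relation.Binary.PropositionalEquality
open import Relation.Nullary using (¬_; yes; no)
open import Relation.Nullary.Decidable using (_×-dec_)
open import Relation.Unary using (Decidable)

𝟙 : Bool → ℕ
𝟙 b = if b then 1 else 0

≤ᵇ-true : ∀ {m n} → m ≤ n → (m ≤ᵇ n) ≡ true
≤ᵇ-true m≤n = Equivalence.to T-≡ (≤⇒≤ᵇ m≤n)

≤ᵇ-true⁻¹ : ∀ {m n} → (m ≤ᵇ n) ≡ true → m ≤ n
≤ᵇ-true⁻¹ {m} {n} eq = ≤ᵇ⇒≤ m n (Equivalence.from T-≡ eq)

≤ᵇ-false : ∀ {m n} → n < m → (m ≤ᵇ n) ≡ false
≤ᵇ-false n<m = ¬-not (λ eq → <⇒≱ n<m (≤ᵇ-true⁻¹ eq))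

≡ᵇ-true : ∀ {m n} → m ≡ n → (m ≡ᵇ n) ≡ true
≡ᵇ-true {m} {n} m≡n = Equivalence.to T-≡ (≡⇒≡ᵇ m n m≡n)

≡ᵇ-true⁻¹ : ∀ {m n} → (m ≡ᵇ n) ≡ true → m ≡ n
≡ᵇ-true⁻¹ {m} {n} eq = ≡ᵇ⇒≡ m n (Equivalence.from T-≡ eq)

≡ᵇ-false : ∀ {m n} → m ≢ n → (m ≡ᵇ n) ≡ false
≡ᵇ-false m≢n = ¬-not (λ eq → m≢n (≡ᵇ-true⁻¹ eq))

true≢false : true ≢ false
true≢false ()

∧-true⁻¹ : ∀ {a b} → (a ∧ b) ≡ true → a ≡ true × b ≡ true
∧-true⁻¹ {true} {true} _ = refl , refl

-- Finite sums and counting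

sumTo-cong : ∀ N {f g : ℕ → ℕ} → (∀ k → 1 ≤ k → k ≤ N → f k ≡ g k) → sumTo N f ≡ sumTo N g
sumTo-cong zero    f≗g = refl
sumTo-cong (suc N) f≗g =
  cong₂ _+_ (sumTo-cong N (λ k 1≤k k≤N → f≗g k 1≤k (m≤n⇒m≤1+n k≤N)))
            (f≗g (suc N) (s≤s z≤n) ≤-refl)

sumTo-zero : ∀ N {f : ℕ → ℕ} → (∀ k → 1 ≤ k → k ≤ N → f k ≡ 0) → sumTo N f ≡ 0
sumTo-zero zero    f≗0 = refl
sumTo-zero (suc N) f≗0 =
  cong₂ _+_ (sumTo-zero N (λ k 1≤k k≤N → f≗0 k 1≤k (m≤n⇒m≤1+n k≤N)))
            (f≗0 (suc N) (s≤s z≤n) ≤-refl)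

sumTo-+ : ∀ N (f g : ℕ → ℕ) → sumTo N (λ k → f k + g k) ≡ sumTo N f + sumTo N g
sumTo-+ zero    f g = refl
sumTo-+ (suc N) f g =
  trans (cong (_+ (f (suc N) + g (suc N))) (sumTo-+ N f g))
        (interchange (sumTo N f) (sumTo N g) (f (suc N)) (g (suc N)))

sumTo-swap : ∀ N M (f : ℕ → ℕ → ℕ) →
  sumTo N (λ x → sumTo M (f x)) ≡ sumTo M (λ y → sumTo N (λ x → f x y))
sumTo-swap zero    M f = sym (sumTo-zero M (λ _ _ _ → refl))
sumTo-swap (suc N) M f =
  trans (cong (_+ sumTo M (f (suc N))) (sumTo-swap N M f))
        (sym (sumTo-+ M (λ y → sumTo N (λ x → f x y)) (f (suc N))))

sumTo-truncate : ∀ {K N} {f : ℕ → ℕ} → K ≤ N → (∀ k → K < k → k ≤ N → f k ≡ 0) →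
  sumTo N f ≡ sumTo K f
sumTo-truncate {f = f} K≤N = go (≤⇒≤′ K≤N)
  where
  go : ∀ {K N} → K ≤′ N → (∀ k → K < k → k ≤ N → f k ≡ 0) → sumTo N f ≡ sumTo K f
  go ≤′-refl        _   = refl
  go (≤′-step K≤′N) f≗0 =
    trans (cong₂ _+_ (go K≤′N (λ k K<k k≤N → f≗0 k K<k (m≤n⇒m≤1+n k≤N)))
                     (f≗0 _ (s≤s (≤′⇒≤ K≤′N)) ≤-refl))
          (+-identityʳ _)

sumTo-delta : ∀ {N p} (v : ℕ) → 1 ≤ p → p ≤ N → sumTo N (λ k → if k ≡ᵇ p then v else 0) ≡ v
sumTo-delta {N} {suc p} v _ p<N = begin
    sumTo N δ
  ≡⟨ sumTo-truncate p<N (λ k p<k _ → cong (if_then v else 0) (≡ᵇ-false (>⇒≢ p<k))) ⟩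
    sumTo p δ + δ (suc p)
  ≡⟨ cong₂ _+_ (sumTo-zero p (λ k _ k≤p → cong (if_then v else 0) (≡ᵇ-false (<⇒≢ (s≤s k≤p)))))
               (cong (if_then v else 0) (≡ᵇ-true {suc p} refl)) ⟩
    v
  ∎
  where
  open ≡-Reasoning
  δ : ℕ → ℕ
  δ k = if k ≡ᵇ suc p then v else 0

𝟙-≤ᵇ-split : ∀ k x → 𝟙 (k ≤ᵇ x) ≡ 𝟙 (suc k ≤ᵇ x) + 𝟙 (x ≡ᵇ k)
𝟙-≤ᵇ-split k x with <-cmp x k
... | tri< x<k _ _ rewrite ≤ᵇ-false x<k | ≤ᵇ-false (m<n⇒m<1+n x<k) | ≡ᵇ-false (<⇒≢ x<k) = refl
... | tri≈ _ refl _ rewrite ≤ᵇ-true (≤-refl {x}) | ≤ᵇ-false (n<1+n x) | ≡ᵇ-true {x} refl = refl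
... | tri> _ _ k<x rewrite ≤ᵇ-true (<⇒≤ k<x) | ≤ᵇ-true k<x | ≡ᵇ-false (>⇒≢ k<x) = refl

𝟙-peel-row : ∀ m b k x →
  𝟙 (m ∧ ((k ≤ᵇ x) ∧ b)) ≡ 𝟙 (m ∧ ((suc k ≤ᵇ x) ∧ b)) + 𝟙 (m ∧ ((x ≡ᵇ k) ∧ b))
𝟙-peel-row false b     k x = refl
𝟙-peel-row true  true  k x
  rewrite ∧-identityʳ (k ≤ᵇ x) | ∧-identityʳ (suc k ≤ᵇ x) | ∧-identityʳ (x ≡ᵇ k) = 𝟙-≤ᵇ-split k x
𝟙-peel-row true  false k x
  rewrite ∧-zeroʳ (k ≤ᵇ x) | ∧-zeroʳ (suc k ≤ᵇ x) | ∧-zeroʳ (x ≡ᵇ k) = refl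

𝟙-peel-col : ∀ m a k y →
  𝟙 (m ∧ (a ∧ (k ≤ᵇ y))) ≡ 𝟙 (m ∧ (a ∧ (suc k ≤ᵇ y))) + 𝟙 (m ∧ (a ∧ (y ≡ᵇ k)))
𝟙-peel-col false a     k y = refl
𝟙-peel-col true  false k y = refl
𝟙-peel-col true  true  k y = 𝟙-≤ᵇ-split k y

count-split : ∀ N {f g h : ℕ → Bool} →
  (∀ k → 1 ≤ k → k ≤ N → 𝟙 (f k) ≡ 𝟙 (g k) + 𝟙 (h k)) → count N f ≡ count N g + count N h
count-split N {g = g} {h} split = trans (sumTo-cong N split) (sumTo-+ N (λ k → 𝟙 (g k)) (λ k → 𝟙 (h k)))

count-mono : ∀ N {f g : ℕ → Bool} → (∀ k → f k ≡ true → g k ≡ true) → count N f ≤ count N g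
count-mono zero    f⇒g = z≤n
count-mono (suc N) {f} {g} f⇒g = +-mono-≤ (count-mono N f⇒g) (𝟙-mono (f (suc N)) (g (suc N)) (f⇒g (suc N)))
  where
  𝟙-mono : ∀ u v → (u ≡ true → v ≡ true) → 𝟙 u ≤ 𝟙 v
  𝟙-mono false v       _   = z≤n
  𝟙-mono true  v u⇒v rewrite u⇒v refl = ≤-refl

count-point : ∀ {N q} (g : ℕ → Bool) → 1 ≤ q → q ≤ N →
  count N (λ y → g y ∧ (y ≡ᵇ q)) ≡ 𝟙 (g q)
count-point {N} {q} g 1≤q q≤N = trans (sumTo-cong N (λ y _ _ → point y)) (sumTo-delta (𝟙 (g q)) 1≤q q≤N)
  where
  point : ∀ y → 𝟙 (g y ∧ (y ≡ᵇ q)) ≡ (if y ≡ᵇ q then 𝟙 (g q) else 0)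
  point y with y ≡ᵇ q in y≡ᵇq
  ... | true  = cong 𝟙 (trans (∧-identityʳ (g y)) (cong g (≡ᵇ-true⁻¹ y≡ᵇq)))
  ... | false = cong 𝟙 (∧-zeroʳ (g y))

count-atLeast : ∀ h {lo} → 1 ≤ lo → lo ≤ suc h → count h (lo ≤ᵇ_) ≡ suc h ∸ lo
count-atLeast zero    (s≤s z≤n) (s≤s z≤n) = refl
count-atLeast (suc h) {lo} 1≤lo lo≤2+h with lo ≤? suc h
... | yes lo≤1+h = begin
    count h (lo ≤ᵇ_) + 𝟙 (lo ≤ᵇ suc h)
  ≡⟨ cong₂ _+_ (count-atLeast h 1≤lo lo≤1+h) (cong 𝟙 (≤ᵇ-true lo≤1+h)) ⟩
    (suc h ∸ lo) + 1
  ≡⟨ +-comm (suc h ∸ lo) 1 ⟩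
    suc (suc h ∸ lo)
  ≡⟨ sym (+-∸-assoc 1 lo≤1+h) ⟩
    suc (suc h) ∸ lo
  ∎
  where open ≡-Reasoning
... | no lo≰1+h rewrite ≤-antisym lo≤2+h (≰⇒> lo≰1+h) =
  trans (sumTo-zero (suc h) (λ k _ k≤1+h → cong 𝟙 (≤ᵇ-false (s≤s k≤1+h)))) (sym (n∸n≡0 (suc h)))

count-interval : ∀ N {lo hi} → 1 ≤ lo → lo ≤ suc hi → hi ≤ N →
  count N (λ y → (lo ≤ᵇ y) ∧ (y ≤ᵇ hi)) ≡ suc hi ∸ lo
count-interval N {lo} {hi} 1≤lo lo≤1+hi hi≤N = begin
    count N (λ y → (lo ≤ᵇ y) ∧ (y ≤ᵇ hi))
  ≡⟨ sumTo-truncate hi≤N (λ y hi<y _ →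
       trans (cong (λ b → 𝟙 ((lo ≤ᵇ y) ∧ b)) (≤ᵇ-false hi<y)) (cong 𝟙 (∧-zeroʳ _))) ⟩
    count hi (λ y → (lo ≤ᵇ y) ∧ (y ≤ᵇ hi))
  ≡⟨ sumTo-cong hi (λ y _ y≤hi →
       trans (cong (λ b → 𝟙 ((lo ≤ᵇ y) ∧ b)) (≤ᵇ-true y≤hi)) (cong 𝟙 (∧-identityʳ _))) ⟩
    count hi (lo ≤ᵇ_)
  ≡⟨ count-atLeast hi 1≤lo lo≤1+hi ⟩
    suc hi ∸ lo
  ∎
  where open ≡-Reasoning

card2-cong : ∀ N {p q : ℕ → ℕ → Bool} → (∀ x y → p x y ≡ q x y) → card2 N p ≡ card2 N q
card2-cong N p≗q = sumTo-cong N (λ x _ _ → sumTo-cong N (λ y _ _ → cong 𝟙 (p≗q x y)))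

card2-split : ∀ N {r p q : ℕ → ℕ → Bool} →
  (∀ x y → 1 ≤ x → x ≤ N → 1 ≤ y → y ≤ N → 𝟙 (r x y) ≡ 𝟙 (p x y) + 𝟙 (q x y)) →
  card2 N r ≡ card2 N p + card2 N q
card2-split N {p = p} {q} split =
  trans (sumTo-cong N (λ x 1≤x x≤N → count-split N (λ y → split x y 1≤x x≤N)))
        (sumTo-+ N (λ x → count N (p x)) (λ x → count N (q x)))

card2-transpose : ∀ N (p : ℕ → ℕ → Bool) → card2 N p ≡ card2 N (λ x y → p y x)
card2-transpose N p = sumTo-swap N N (λ x y → 𝟙 (p x y))

card2-row : ∀ {N r} (g : ℕ → ℕ → Bool) (h : ℕ → Bool) → 1 ≤ r → r ≤ N →
  card2 N (λ x y → g x y ∧ ((x ≡ᵇ r) ∧ h y)) ≡ count N (λ y → g r y ∧ h y)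
card2-row {N} {r} g h 1≤r r≤N =
  trans (sumTo-cong N (λ x _ _ → row x)) (sumTo-delta (count N (λ y → g r y ∧ h y)) 1≤r r≤N)
  where
  row : ∀ x → count N (λ y → g x y ∧ ((x ≡ᵇ r) ∧ h y)) ≡
              (if x ≡ᵇ r then count N (λ y → g r y ∧ h y) else 0)
  row x with x ≡ᵇ r in x≡ᵇr
  ... | true  = cong (λ x → count N (λ y → g x y ∧ h y)) (≡ᵇ-true⁻¹ x≡ᵇr)
  ... | false = sumTo-zero N (λ y _ _ → cong 𝟙 (∧-zeroʳ (g x y)))

card2-col : ∀ {N c} (g : ℕ → ℕ → Bool) (h : ℕ → Bool) → 1 ≤ c → c ≤ N →
  card2 N (λ x y → g x y ∧ (h x ∧ (y ≡ᵇ c))) ≡ count N (λ x → g x c ∧ h x)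
card2-col {N} {c} g h 1≤c c≤N = begin
    card2 N (λ x y → g x y ∧ (h x ∧ (y ≡ᵇ c)))
  ≡⟨ card2-transpose N _ ⟩
    card2 N (λ x y → g y x ∧ (h y ∧ (x ≡ᵇ c)))
  ≡⟨ card2-cong N (λ x y → cong (g y x ∧_) (∧-comm (h y) (x ≡ᵇ c))) ⟩
    card2 N (λ x y → g y x ∧ ((x ≡ᵇ c) ∧ h y))
  ≡⟨ card2-row (λ x y → g y x) h 1≤c c≤N ⟩
    count N (λ y → g y c ∧ h y)
  ∎
  where open ≡-Reasoning

card2-truncate : ∀ {K N} (p : ℕ → ℕ → Bool) → K ≤ N → (∀ x y → p x y ≡ true → x ≤ K × y ≤ K) →
  card2 N p ≡ card2 K p
card2-truncate {K} {N} p K≤N supp = trans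
  (sumTo-cong N (λ x _ _ → sumTo-truncate K≤N (λ y K<y _ →
    cong 𝟙 (¬-not (λ pxy → <⇒≱ K<y (proj₂ (supp x y pxy)))))))
  (sumTo-truncate K≤N (λ x K<x _ → sumTo-zero K (λ y _ _ →
    cong 𝟙 (¬-not (λ pxy → <⇒≱ K<x (proj₁ (supp x y pxy)))))))

minTo-≤ : ∀ (f : ℕ → ℕ) {k i} → i ≤ k → minTo f k ≤ f i
minTo-≤ f {zero}  z≤n = ≤-refl
minTo-≤ f {suc k} {i} i≤1+k with i ≟ suc k
... | yes refl  = m⊓n≤n (minTo f k) (f (suc k))
... | no i≢1+k =
  ≤-trans (m⊓n≤m (minTo f k) (f (suc k))) (minTo-≤ f (s≤s⁻¹ (≤∧≢⇒< i≤1+k i≢1+k)))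

minTo-attained : ∀ (f : ℕ → ℕ) k → ∃[ i ] i ≤ k × f i ≡ minTo f k
minTo-attained f zero = 0 , z≤n , refl
minTo-attained f (suc k) with ⊓-sel (minTo f k) (f (suc k))
... | inj₁ min≡ =
  let (i , i≤k , fi≡) = minTo-attained f k in i , m≤n⇒m≤1+n i≤k , trans fi≡ (sym min≡)
... | inj₂ min≡ = suc k , ≤-refl , sym min≡

minTo-glb : ∀ (f : ℕ → ℕ) k {μ} → (∀ i → i ≤ k → μ ≤ f i) → μ ≤ minTo f k
minTo-glb f zero    μ≤f = μ≤f 0 z≤n
minTo-glb f (suc k) μ≤f =
  ⊓-glb (minTo-glb f k (λ i i≤k → μ≤f i (m≤n⇒m≤1+n i≤k))) (μ≤f (suc k) ≤-refl)

step-down : (P : ℕ → Bool) → ∀ {lo hi} → lo ≤ hi → P lo ≡ true → P hi ≡ false →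
  ∃[ p ] lo ≤ p × p < hi × P p ≡ true × P (suc p) ≡ false
step-down P {hi = zero}  z≤n Plo Phi = ⊥-elim (true≢false (trans (sym Plo) Phi))
step-down P {lo} {suc h} lo≤1+h Plo P1+h with lo ≟ suc h
... | yes refl = ⊥-elim (true≢false (trans (sym Plo) P1+h))
... | no lo≢1+h with P h in Ph
...   | true  = h , lo≤h , ≤-refl , Ph , P1+h
  where
  lo≤h : lo ≤ h
  lo≤h = s≤s⁻¹ (≤∧≢⇒< lo≤1+h lo≢1+h)
...   | false =
  let (p , lo≤p , p<h , Pp , P1+p) = step-down P (s≤s⁻¹ (≤∧≢⇒< lo≤1+h lo≢1+h)) Plo Ph
  in p , lo≤p , m<n⇒m<1+n p<h , Pp , P1+p

least : ∀ {P : ℕ → Set} → Decidable P → ∀ {k} → P k →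
  ∃[ j ] j ≤ k × P j × (∀ {i} → i < j → ¬ P i)
least {P} P? {k} Pk = search k (k , ≤-refl , Pk)
  where
  search : ∀ k → (∃[ i ] i ≤ k × P i) → ∃[ j ] j ≤ k × P j × (∀ {i} → i < j → ¬ P i)
  search zero (_ , z≤n , P0) = 0 , z≤n , P0 , λ ()
  search (suc k) (i , i≤1+k , Pi) with anyUpTo? P? (suc k)
  ... | yes (i′ , i′<1+k , Pi′) =
    let (j , j≤k , Pj , below) = search k (i′ , s≤s⁻¹ i′<1+k , Pi′)
    in j , m≤n⇒m≤1+n j≤k , Pj , below
  ... | no none = i , i≤1+k , Pi , λ i′<i Pi′ → none (_ , <-≤-trans i′<i i≤1+k , Pi′)

greatest : ∀ {P : ℕ → Set} → Decidable P → ∀ {k hi} → k ≤ hi → P k →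
  ∃[ j ] k ≤ j × j ≤ hi × P j × (∀ {i} → j < i → i ≤ hi → ¬ P i)
greatest {P} P? {k} {hi} k≤hi Pk with P? hi
... | yes Phi = hi , k≤hi , ≤-refl , Phi , λ hi<i i≤hi → ⊥-elim (<⇒≱ hi<i i≤hi)
greatest P? {hi = zero} z≤n Pk | no ¬Phi = ⊥-elim (¬Phi Pk)
greatest {P} P? {k} {suc h} k≤1+h Pk | no ¬Phi with k ≟ suc h
... | yes refl = ⊥-elim (¬Phi Pk)
... | no k≢1+h =
  let (j , k≤j , j≤h , Pj , above) = greatest P? (s≤s⁻¹ (≤∧≢⇒< k≤1+h k≢1+h)) Pk
  in j , k≤j , m≤n⇒m≤1+n j≤h , Pj , above′ above
  where
  above′ : ∀ {j} → (∀ {i} → j < i → i ≤ h → ¬ P i) → ∀ {i} → j < i → i ≤ suc h → ¬ P i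
  above′ above {i} j<i i≤1+h with i ≟ suc h
  ... | yes refl = ¬Phi
  ... | no i≢1+h = above j<i (s≤s⁻¹ (≤∧≢⇒< i≤1+h i≢1+h))

-- Ferrers diagrams

isCell : ℕ → ℕ → ℕ → ℕ → Bool
isCell p q x y = (x ≡ᵇ p) ∧ (y ≡ᵇ q)

isCell-true : ∀ {p q x y} → x ≡ p → y ≡ q → isCell p q x y ≡ true
isCell-true x≡p y≡q = cong₂ _∧_ (≡ᵇ-true x≡p) (≡ᵇ-true y≡q)

isCell-true⁻¹ : ∀ {p q x y} → isCell p q x y ≡ true → x ≡ p × y ≡ q
isCell-true⁻¹ eq = let (x≡p , y≡q) = ∧-true⁻¹ eq in ≡ᵇ-true⁻¹ x≡p , ≡ᵇ-true⁻¹ y≡q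

isCell-false : ∀ {p q x y} → ¬ (x ≡ p × y ≡ q) → isCell p q x y ≡ false
isCell-false ≢P = ¬-not (λ eq → ≢P (isCell-true⁻¹ eq))

quadrant : ℕ → ℕ → ℕ → ℕ → Bool
quadrant d j x y = ((d ∸ j) ≤ᵇ x) ∧ (suc j ≤ᵇ y)

quadrant-true : ∀ {d j x y} → d ∸ j ≤ x → j < y → quadrant d j x y ≡ true
quadrant-true d∸j≤x j<y = cong₂ _∧_ (≤ᵇ-true d∸j≤x) (≤ᵇ-true j<y)

quadrant-true⁻¹ : ∀ d j x y → quadrant d j x y ≡ true → d ∸ j ≤ x × j < y
quadrant-true⁻¹ d j x y inQ =
  let (d∸j≤x , j<y) = ∧-true⁻¹ {d ∸ j ≤ᵇ x} {suc j ≤ᵇ y} inQ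
  in ≤ᵇ-true⁻¹ d∸j≤x , ≤ᵇ-true⁻¹ {suc j} j<y

transpose : ∀ {n} → FerrersDiagram n → FerrersDiagram n
transpose D = record
  { mem        = λ x y → mem D y x
  ; bounded    = λ x y yx∈D → swap (bounded D y x yx∈D)
  ; downClosed = λ x y i j yx∈D 1≤i i≤x 1≤j j≤y → downClosed D y x j i yx∈D 1≤j j≤y 1≤i i≤x
  }

RowWithin : ∀ {n} → FerrersDiagram n → ℕ → Set
RowWithin D r = ∀ y → mem D r y ≡ true → mem D (suc r) y ≡ true

ColWithin : ∀ {n} → FerrersDiagram n → ℕ → Set
ColWithin D c = RowWithin (transpose D) c

module _ {n : ℕ} (D : FerrersDiagram n) where

  1≤row : ∀ {x y} → mem D x y ≡ true → 1 ≤ x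
  1≤row {x} {y} xy∈D = proj₁ (proj₁ (bounded D x y xy∈D))

  1≤col : ∀ {x y} → mem D x y ≡ true → 1 ≤ y
  1≤col {x} {y} xy∈D = proj₁ (proj₂ (bounded D x y xy∈D))

  row≤n : ∀ {x y} → mem D x y ≡ true → x ≤ n
  row≤n {x} {y} xy∈D = proj₂ (proj₁ (bounded D x y xy∈D))

  col≤n : ∀ {x y} → mem D x y ≡ true → y ≤ n
  col≤n {x} {y} xy∈D = proj₂ (proj₂ (bounded D x y xy∈D))

  absent-beyond : ∀ {x y x′ y′} → mem D x y ≡ false → 1 ≤ x → 1 ≤ y → x ≤ x′ → y ≤ y′ →
    mem D x′ y′ ≡ false
  absent-beyond xy∉D 1≤x 1≤y x≤x′ y≤y′ = ¬-not (λ x′y′∈D →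
    true≢false (trans (sym (downClosed D _ _ _ _ x′y′∈D 1≤x x≤x′ 1≤y y≤y′)) xy∉D))

  row-gap : ∀ {x q y} → mem D x q ≡ true → mem D x y ≡ false → 1 ≤ y → q < y
  row-gap xq∈D xy∉D 1≤y = ≰⇒> (λ y≤q →
    true≢false (trans (sym xq∈D) (absent-beyond xy∉D (1≤row xq∈D) 1≤y ≤-refl y≤q)))

  row-end : ∀ {x y} → mem D x y ≡ true → ∃[ q ] y ≤ q × mem D x q ≡ true × mem D x (suc q) ≡ false
  row-end {x} {y} xy∈D =
    let (q , y≤q , _ , xq∈D , xq+1∉D) = step-down (mem D x) (m≤n⇒m≤1+n (col≤n xy∈D)) xy∈D beyond-n
    in q , y≤q , xq∈D , xq+1∉D
    where
    beyond-n : mem D x (suc n) ≡ false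
    beyond-n = ¬-not (λ xn+1∈D → 1+n≰n (col≤n xn+1∈D))

  row-within? : ∀ r → (∃[ y ] mem D r y ≡ true × mem D (suc r) y ≡ false) ⊎ RowWithin D r
  row-within? r with anyUpTo? (λ y → (mem D r y Bool.≟ true) ×-dec (mem D (suc r) y Bool.≟ false)) (suc n)
  ... | yes (y , _ , ry∈D , r+1y∉D) = inj₁ (y , ry∈D , r+1y∉D)
  ... | no none = inj₂ (λ y ry∈D → ¬-not (λ r+1y∉D → none (y , s≤s (col≤n ry∈D) , ry∈D , r+1y∉D)))

col-gap : ∀ {n} (D : FerrersDiagram n) {p x y} → mem D p y ≡ true → mem D x y ≡ false → 1 ≤ x → p < x
col-gap D = row-gap (transpose D)

col-end : ∀ {n} (D : FerrersDiagram n) {x y} → mem D x y ≡ true →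
  ∃[ p ] x ≤ p × mem D p y ≡ true × mem D (suc p) y ≡ false
col-end D = row-end (transpose D)

col-within? : ∀ {n} (D : FerrersDiagram n) c →
  (∃[ x ] mem D x c ≡ true × mem D x (suc c) ≡ false) ⊎ ColWithin D c
col-within? D = row-within? (transpose D)

corner-maximal : ∀ {n} (D : FerrersDiagram n) {p q x y} →
  mem D (suc p) q ≡ false → mem D p (suc q) ≡ false →
  mem D x y ≡ true → 1 ≤ p → 1 ≤ q → p ≤ x → q ≤ y → x ≡ p × y ≡ q
corner-maximal D {p} {q} {x} {y} below right xy∈D 1≤p 1≤q p≤x q≤y =
  ≤-antisym (s≤s⁻¹ (col-gap D xq∈D below (s≤s z≤n))) p≤x , ≤-antisym (s≤s⁻¹ (row-gap D py∈D right (s≤s z≤n))) q≤y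
  where
  xq∈D : mem D x q ≡ true
  xq∈D = downClosed D x y x q xy∈D (1≤row D xy∈D) ≤-refl 1≤q q≤y
  py∈D : mem D p y ≡ true
  py∈D = downClosed D x y p y xy∈D 1≤p p≤x (1≤col D xy∈D) ≤-refl

-- Removing and adding a cell

module PointRemoval {m n : ℕ} (D′ : FerrersDiagram m) (D : FerrersDiagram n) (p q : ℕ)
                    (rem : IsPointRemoval D′ D p q) where

  private
    P∈D : mem D p q ≡ true
    P∈D = proj₁ rem
    D′≡ : ∀ x y → mem D′ x y ≡ (mem D x y ∧ not (isCell p q x y))
    D′≡ = proj₂ rem

  removed-cell-absent : mem D′ p q ≡ false
  removed-cell-absent =
    trans (D′≡ p q) (trans (cong (λ b → mem D p q ∧ not b) (isCell-true {p} {q} refl refl)) (∧-zeroʳ _))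

  removal-keeps : ∀ {x y} → ¬ (x ≡ p × y ≡ q) → mem D′ x y ≡ mem D x y
  removal-keeps {x} {y} ≢P =
    trans (D′≡ x y) (trans (cong (λ b → mem D x y ∧ not b) (isCell-false ≢P)) (∧-identityʳ _))

  removal-below : ∀ {x y} → 1 ≤ x → x ≤ p → 1 ≤ y → y ≤ q → ¬ (x ≡ p × y ≡ q) →
    mem D′ x y ≡ true
  removal-below {x} {y} 1≤x x≤p 1≤y y≤q ≢P =
    trans (removal-keeps ≢P) (downClosed D p q x y P∈D 1≤x x≤p 1≤y y≤q)

  removal-⊆ : ∀ {x y} → mem D′ x y ≡ true → mem D x y ≡ true
  removal-⊆ {x} {y} xy∈D′ = proj₁ (∧-true⁻¹ (trans (sym (D′≡ x y)) xy∈D′))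

  removed-cell-is-corner : mem D (suc p) q ≡ false × mem D p (suc q) ≡ false
  removed-cell-is-corner =
    trans (sym (removal-keeps (λ (1+p≡p , _) → 1+n≢n 1+p≡p)))
          (absent-beyond D′ removed-cell-absent (1≤row D P∈D) (1≤col D P∈D) (n≤1+n p) ≤-refl) ,
    trans (sym (removal-keeps (λ (_ , 1+q≡q) → 1+n≢n 1+q≡q)))
          (absent-beyond D′ removed-cell-absent (1≤row D P∈D) (1≤col D P∈D) ≤-refl (n≤1+n q))

  ν-removal : ∀ d j → ν D′ d j + 𝟙 (quadrant d j p q) ≡ ν D d j
  ν-removal d j = sym (begin
      ν D d j
    ≡⟨ card2-split n (λ x y _ _ _ _ → split x y) ⟩
      card2 n inD′ + card2 n (λ x y → Q x y ∧ isCell p q x y)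
    ≡⟨ cong₂ _+_ (trans (sym (card2-truncate inD′ (m≤n+m n m) supp-n))
                        (card2-truncate inD′ (m≤m+n m n) supp-m))
                 (card2-row Q (_≡ᵇ q) (1≤row D P∈D) (row≤n D P∈D)) ⟩
      ν D′ d j + count n (λ y → Q p y ∧ (y ≡ᵇ q))
    ≡⟨ cong (λ k → ν D′ d j + k) (count-point (Q p) (1≤col D P∈D) (col≤n D P∈D)) ⟩
      ν D′ d j + 𝟙 (Q p q)
    ∎)
    where
    open ≡-Reasoning
    Q inD′ : ℕ → ℕ → Bool
    Q = quadrant d j
    inD′ x y = mem D′ x y ∧ Q x y
    supp-m : ∀ x y → inD′ x y ≡ true → x ≤ m × y ≤ m
    supp-m x y in′ = let xy∈D′ = proj₁ (∧-true⁻¹ in′) in row≤n D′ xy∈D′ , col≤n D′ xy∈D′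
    supp-n : ∀ x y → inD′ x y ≡ true → x ≤ n × y ≤ n
    supp-n x y in′ = let xy∈D = removal-⊆ (proj₁ (∧-true⁻¹ in′)) in row≤n D xy∈D , col≤n D xy∈D
    split : ∀ x y → 𝟙 (mem D x y ∧ Q x y) ≡ 𝟙 (inD′ x y) + 𝟙 (Q x y ∧ isCell p q x y)
    split x y with isCell p q x y in atP
    ... | false = trans (sym (+-identityʳ _))
                        (cong₂ _+_ (cong (λ b → 𝟙 (b ∧ Q x y)) (sym kept)) (cong 𝟙 (sym (∧-zeroʳ (Q x y)))))
      where
      kept : mem D′ x y ≡ mem D x y
      kept = trans (D′≡ x y) (trans (cong (λ b → mem D x y ∧ not b) atP) (∧-identityʳ _))
    ... | true = trans (cong (λ b → 𝟙 (b ∧ Q x y)) xy∈D)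
                       (trans (cong 𝟙 (sym (∧-identityʳ (Q x y))))
                              (cong (λ b → 𝟙 (b ∧ Q x y) + 𝟙 (Q x y ∧ true)) (sym xy∉D′)))
      where
      xy∉D′ : mem D′ x y ≡ false
      xy∉D′ = trans (D′≡ x y) (trans (cong (λ b → mem D x y ∧ not b) atP) (∧-zeroʳ _))
      xy∈D : mem D x y ≡ true
      xy∈D = let (x≡p , y≡q) = isCell-true⁻¹ atP
             in subst₂ (λ u v → mem D u v ≡ true) (sym x≡p) (sym y≡q) P∈D

  ν-removal-inside : ∀ {d j} → quadrant d j p q ≡ true → suc (ν D′ d j) ≡ ν D d j
  ν-removal-inside {d} {j} inQ =
    trans (+-comm 1 (ν D′ d j)) (trans (cong (λ b → ν D′ d j + 𝟙 b) (sym inQ)) (ν-removal d j))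

  ν-removal-outside : ∀ {d j} → quadrant d j p q ≡ false → ν D′ d j ≡ ν D d j
  ν-removal-outside {d} {j} outQ =
    trans (sym (+-identityʳ _)) (trans (cong (λ b → ν D′ d j + 𝟙 b) (sym outQ)) (ν-removal d j))

  νmin-drops : ∀ {d k} → k ≤ d ∸ 1 → ν D d k ≡ νmin D d → quadrant d k p q ≡ true →
    νmin D′ d < νmin D d
  νmin-drops {d} {k} k≤ νk≡ inQ = begin-strict
      νmin D′ d  ≤⟨ minTo-≤ (ν D′ d) k≤ ⟩
      ν D′ d k   <⟨ ≤-reflexive (ν-removal-inside inQ) ⟩
      ν D d k    ≡⟨ νk≡ ⟩
      νmin D d   ∎
    where open ≤-Reasoning

  νmin-kept-by-removal : ∀ {d} → (∀ i → i ≤ d ∸ 1 → quadrant d i p q ≡ true → νmin D d < ν D d i) →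
    νmin D′ d ≡ νmin D d
  νmin-kept-by-removal {d} blocked with minTo-attained (ν D d) (d ∸ 1)
  ... | k , k≤ , νk≡ = ≤-antisym upper (minTo-glb (ν D′ d) (d ∸ 1) lower)
    where
    k-outside : quadrant d k p q ≡ false
    k-outside = ¬-not (λ inQ → <⇒≢ (blocked k k≤ inQ) (sym νk≡))
    upper : νmin D′ d ≤ νmin D d
    upper = ≤-trans (minTo-≤ (ν D′ d) k≤) (≤-reflexive (trans (ν-removal-outside k-outside) νk≡))
    lower : ∀ i → i ≤ d ∸ 1 → νmin D d ≤ ν D′ d i
    lower i i≤ with quadrant d i p q in Qi
    ... | true  = s≤s⁻¹ (≤-trans (blocked i i≤ Qi) (≤-reflexive (sym (ν-removal-inside Qi))))
    ... | false = ≤-trans (minTo-≤ (ν D d) i≤) (≤-reflexive (sym (ν-removal-outside Qi)))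

  νmin-kept-by-addition : ∀ {d k} → k ≤ d ∸ 1 → ν D′ d k ≡ νmin D′ d → quadrant d k p q ≡ false →
    νmin D d ≡ νmin D′ d
  νmin-kept-by-addition {d} {k} k≤ νk≡ outQ = ≤-antisym upper (minTo-glb (ν D d) (d ∸ 1) lower)
    where
    upper : νmin D d ≤ νmin D′ d
    upper = ≤-trans (minTo-≤ (ν D d) k≤) (≤-reflexive (trans (sym (ν-removal-outside outQ)) νk≡))
    lower : ∀ i → i ≤ d ∸ 1 → νmin D′ d ≤ ν D d i
    lower i i≤ = ≤-trans (minTo-≤ (ν D′ d) i≤) (≤-trans (m≤m+n _ _) (≤-reflexive (ν-removal d i)))

  νmin-changed-by-addition : ∀ {d} →
    (∀ i → i ≤ d ∸ 1 → ν D′ d i ≡ νmin D′ d → quadrant d i p q ≡ true) → νmin D′ d ≢ νmin D d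
  νmin-changed-by-addition {d} forced νmin≡ with minTo-attained (ν D d) (d ∸ 1)
  ... | k , k≤ , νk≡ with quadrant d k p q in Qk
  ...   | true  = <⇒≢ (νmin-drops k≤ νk≡ Qk) νmin≡
  ...   | false = true≢false (trans (sym (forced k k≤ νk≡′)) Qk)
    where
    νk≡′ : ν D′ d k ≡ νmin D′ d
    νk≡′ = trans (ν-removal-outside Qk) (trans νk≡ (sym νmin≡))

removeCell : ∀ {n} (D : FerrersDiagram n) {p q} →
  mem D p q ≡ true → mem D (suc p) q ≡ false → mem D p (suc q) ≡ false →
  Σ (FerrersDiagram n) λ D′ → IsPointRemoval D′ D p q
removeCell {n} D {p} {q} P∈D below right = D′ , P∈D , λ _ _ → refl
  where
  closed : ∀ x y i j → (mem D x y ∧ not (isCell p q x y)) ≡ true → 1 ≤ i → i ≤ x → 1 ≤ j → j ≤ y →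
    (mem D i j ∧ not (isCell p q i j)) ≡ true
  closed x y i j xy∈D′ 1≤i i≤x 1≤j j≤y =
    let (xy∈D , xy≢P) = ∧-true⁻¹ xy∈D′
    in cong₂ _∧_ (downClosed D x y i j xy∈D 1≤i i≤x 1≤j j≤y) (cong not (isCell-false (ij≢P xy∈D xy≢P)))
    where
    ij≢P : mem D x y ≡ true → not (isCell p q x y) ≡ true → ¬ (i ≡ p × j ≡ q)
    ij≢P xy∈D xy≢P (refl , refl) =
      let (x≡p , y≡q) = corner-maximal D below right xy∈D (1≤row D P∈D) (1≤col D P∈D) i≤x j≤y
      in true≢false (trans (sym xy≢P) (cong not (isCell-true x≡p y≡q)))
  D′ : FerrersDiagram n
  D′ = record
    { mem        = λ x y → mem D x y ∧ not (isCell p q x y)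
    ; bounded    = λ x y xy∈D′ → bounded D x y (proj₁ (∧-true⁻¹ xy∈D′))
    ; downClosed = closed
    }

SupportedAbove : ∀ {n} → FerrersDiagram n → ℕ → ℕ → Set
SupportedAbove D p q = p ≡ 1 ⊎ mem D (p ∸ 1) q ≡ true

SupportedLeft : ∀ {n} → FerrersDiagram n → ℕ → ℕ → Set
SupportedLeft D p q = SupportedAbove (transpose D) q p

supportedAbove-bounds : ∀ {n} (D : FerrersDiagram n) {p q} → SupportedAbove D p q → 1 ≤ p × p ≤ suc n
supportedAbove-bounds D (inj₁ refl) = s≤s z≤n , s≤s z≤n
supportedAbove-bounds D {zero}  (inj₂ above∈D) = ⊥-elim (<-irrefl refl (1≤row D above∈D))
supportedAbove-bounds D {suc p} (inj₂ above∈D) = s≤s z≤n , s≤s (row≤n D above∈D)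

supportedAbove-closed : ∀ {n} (D : FerrersDiagram n) {p q} → SupportedAbove D p q →
  ∀ {i j} → 1 ≤ i → i < p → 1 ≤ j → j ≤ q → mem D i j ≡ true
supportedAbove-closed D (inj₁ refl) 1≤i i<p _ _ = ⊥-elim (<⇒≱ i<p 1≤i)
supportedAbove-closed D {p} {q} (inj₂ above∈D) 1≤i i<p 1≤j j≤q =
  downClosed D (p ∸ 1) q _ _ above∈D 1≤i (∸-monoˡ-≤ 1 i<p) 1≤j j≤q

addCell : ∀ {n} (D : FerrersDiagram n) {p q} →
  mem D p q ≡ false → SupportedAbove D p q → SupportedLeft D p q →
  Σ (FerrersDiagram (suc n)) λ D′ → IsPointRemoval D D′ p q
addCell {n} D {p} {q} P∉D above left = D′ , P∈D′ , removal
  where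
  P∈D′ : (mem D p q ∨ isCell p q p q) ≡ true
  P∈D′ = trans (cong (mem D p q ∨_) (isCell-true {p} {q} refl refl)) (∨-zeroʳ _)
  bnd : ∀ x y → (mem D x y ∨ isCell p q x y) ≡ true → (1 ≤ x × x ≤ suc n) × (1 ≤ y × y ≤ suc n)
  bnd x y xy∈D′ with mem D x y in xy∈D
  ... | true  = (1≤row D xy∈D , m≤n⇒m≤1+n (row≤n D xy∈D)) ,
                (1≤col D xy∈D , m≤n⇒m≤1+n (col≤n D xy∈D))
  ... | false with isCell-true⁻¹ {p} {q} {x} {y} xy∈D′
  ...   | refl , refl = supportedAbove-bounds D above , supportedAbove-bounds (transpose D) left
  closed : ∀ x y i j → (mem D x y ∨ isCell p q x y) ≡ true → 1 ≤ i → i ≤ x → 1 ≤ j → j ≤ y →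
    (mem D i j ∨ isCell p q i j) ≡ true
  closed x y i j xy∈D′ 1≤i i≤x 1≤j j≤y with mem D x y in xy∈D
  ... | true = cong (_∨ isCell p q i j) (downClosed D x y i j xy∈D 1≤i i≤x 1≤j j≤y)
  ... | false with isCell-true⁻¹ {p} {q} {x} {y} xy∈D′
  ...   | refl , refl with i ≟ x | j ≟ y
  ...     | yes refl | yes refl = P∈D′
  ...     | no i≢p   | _        =
    cong (_∨ isCell p q i j) (supportedAbove-closed D above 1≤i (≤∧≢⇒< i≤x i≢p) 1≤j j≤y)
  ...     | yes refl | no j≢q   =
    cong (_∨ isCell p q i j) (supportedAbove-closed (transpose D) left 1≤j (≤∧≢⇒< j≤y j≢q) 1≤i i≤x)
  D′ : FerrersDiagram (suc n)
  D′ = record { mem = λ x y → mem D x y ∨ isCell p q x y ; bounded = bnd ; downClosed = closed }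
  removal : ∀ x y → mem D x y ≡ ((mem D x y ∨ isCell p q x y) ∧ not (isCell p q x y))
  removal x y with isCell p q x y in atP
  ... | false = sym (trans (∧-identityʳ _) (∨-identityʳ _))
  ... | true with isCell-true⁻¹ {p} {q} {x} {y} atP
  ...   | refl , refl = trans P∉D (sym (∧-zeroʳ _))

module _ {n : ℕ} {d : ℕ} (D : FerrersDiagram n) where

  reducible-by-removal : ∀ {p q} → mem D p q ≡ true → mem D (suc p) q ≡ false → mem D p (suc q) ≡ false →
    (∀ i → i ≤ d ∸ 1 → quadrant d i p q ≡ true → νmin D d < ν D d i) → Reducible D d
  reducible-by-removal {p} {q} P∈D below right blocked =
    let (D′ , rem) = removeCell D P∈D below right
    in n , D′ , inj₁ (p , q , rem , PointRemoval.νmin-kept-by-removal D′ D p q rem blocked)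

  reducible-by-addition : ∀ {p q} → mem D p q ≡ false → SupportedAbove D p q → SupportedLeft D p q →
    (∀ i → i ≤ d ∸ 1 → ν D d i ≡ νmin D d → quadrant d i p q ≡ true) → Reducible D d
  reducible-by-addition {p} {q} P∉D above left forced =
    let (D′ , rem) = addCell D P∉D above left
    in suc n , D′ , inj₂ (p , q , rem , PointRemoval.νmin-changed-by-addition D D′ p q rem forced)

-- Consecutive values of ν

rowTail : ∀ {n} → FerrersDiagram n → ℕ → ℕ → ℕ
rowTail {n} D r k = count n (λ y → mem D r y ∧ (k ≤ᵇ y))

colTail : ∀ {n} → FerrersDiagram n → ℕ → ℕ → ℕ
colTail D = rowTail (transpose D)

rowTail-within : ∀ {n} (D : FerrersDiagram n) {r} k → RowWithin D r →
  rowTail D r (suc k) ≤ rowTail D (suc r) k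
rowTail-within {n} D {r} k within = count-mono n (λ y ry∈tail →
  let (ry∈D , k<y) = ∧-true⁻¹ ry∈tail
  in cong₂ _∧_ (within y ry∈D) (≤ᵇ-true (<⇒≤ (≤ᵇ-true⁻¹ {suc k} {y} k<y))))

ν-step : ∀ {n} (D : FerrersDiagram n) {d j r} → d ≡ suc r + j → 1 ≤ r → r + j ≤ n →
  ν D d j + rowTail D r (suc (suc j)) ≡ ν D d (suc j) + colTail D (suc j) (suc r)
ν-step {n} D {d} {j} {r} d≡ 1≤r r+j≤n = begin
    ν D d j + R        ≡⟨ cong (_+ R) split-col ⟩
    card2 n S + C + R  ≡⟨ xy∙z≈xz∙y (card2 n S) C R ⟩
    card2 n S + R + C  ≡⟨ cong (_+ C) (sym split-row) ⟩
    ν D d (suc j) + C  ∎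
  where
  open ≡-Reasoning
  R C : ℕ
  R = rowTail D r (suc (suc j))
  C = colTail D (suc j) (suc r)
  S : ℕ → ℕ → Bool
  S x y = mem D x y ∧ ((suc r ≤ᵇ x) ∧ (suc (suc j) ≤ᵇ y))
  d∸j≡ : d ∸ j ≡ suc r
  d∸j≡ = trans (cong (_∸ j) d≡) (m+n∸n≡m (suc r) j)
  d∸1+j≡ : d ∸ suc j ≡ r
  d∸1+j≡ = trans (cong (_∸ suc j) (trans d≡ (sym (+-suc r j)))) (m+n∸n≡m r (suc j))
  r≤n : r ≤ n
  r≤n = ≤-trans (m≤m+n r j) r+j≤n
  1+j≤n : suc j ≤ n
  1+j≤n = ≤-trans (+-monoˡ-≤ j 1≤r) r+j≤n
  split-col : ν D d j ≡ card2 n S + C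
  split-col = begin
      ν D d j
    ≡⟨ card2-cong n (λ x y → cong (λ k → mem D x y ∧ ((k ≤ᵇ x) ∧ (suc j ≤ᵇ y))) d∸j≡) ⟩
      card2 n (λ x y → mem D x y ∧ ((suc r ≤ᵇ x) ∧ (suc j ≤ᵇ y)))
    ≡⟨ card2-split n (λ x y _ _ _ _ → 𝟙-peel-col (mem D x y) (suc r ≤ᵇ x) (suc j) y) ⟩
      card2 n S + card2 n (λ x y → mem D x y ∧ ((suc r ≤ᵇ x) ∧ (y ≡ᵇ suc j)))
    ≡⟨ cong (λ m → card2 n S + m) (card2-col (mem D) (suc r ≤ᵇ_) (s≤s z≤n) 1+j≤n) ⟩
      card2 n S + C
    ∎
  split-row : ν D d (suc j) ≡ card2 n S + R
  split-row = begin
      ν D d (suc j)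
    ≡⟨ card2-cong n (λ x y → cong (λ k → mem D x y ∧ ((k ≤ᵇ x) ∧ (suc (suc j) ≤ᵇ y))) d∸1+j≡) ⟩
      card2 n (λ x y → mem D x y ∧ ((r ≤ᵇ x) ∧ (suc (suc j) ≤ᵇ y)))
    ≡⟨ card2-split n (λ x y _ _ _ _ → 𝟙-peel-row (mem D x y) (suc (suc j) ≤ᵇ y) r x) ⟩
      card2 n S + card2 n (λ x y → mem D x y ∧ ((x ≡ᵇ r) ∧ (suc (suc j) ≤ᵇ y)))
    ≡⟨ cong (λ m → card2 n S + m) (card2-row (mem D) (suc (suc j) ≤ᵇ_) 1≤r r≤n) ⟩
      card2 n S + R
    ∎

ν-concave : ∀ {n} (D : FerrersDiagram n) {d j r} → d ≡ suc r + suc j → 1 ≤ r → r + suc j ≤ n →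
  RowWithin D r → ColWithin D (suc j) → ν D d j + ν D d (suc (suc j)) ≤ ν D d (suc j) + ν D d (suc j)
ν-concave {n} D {d} {j} {r} d≡ 1≤r bound rows cols = +-cancelʳ-≤ (R₁ + C₀) _ _ (begin
    (ν₀ + ν₂) + (R₁ + C₀)  ≡⟨ interchange ν₀ ν₂ R₁ C₀ ⟩
    (ν₀ + R₁) + (ν₂ + C₀)  ≡⟨ cong₂ _+_ step₀ (sym step₁) ⟩
    (ν₁ + C₁) + (ν₁ + R₀)  ≤⟨ +-mono-≤ (+-monoʳ-≤ ν₁ (rowTail-within (transpose D) (suc r) cols))
                                       (+-monoʳ-≤ ν₁ (rowTail-within D (suc (suc j)) rows)) ⟩
    (ν₁ + C₀) + (ν₁ + R₁)  ≡⟨ interchange ν₁ C₀ ν₁ R₁ ⟩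
    (ν₁ + ν₁) + (C₀ + R₁)  ≡⟨ cong (λ m → ν₁ + ν₁ + m) (+-comm C₀ R₁) ⟩
    (ν₁ + ν₁) + (R₁ + C₀)  ∎)
  where
  open ≤-Reasoning
  ν₀ ν₁ ν₂ R₀ R₁ C₀ C₁ : ℕ
  ν₀ = ν D d j
  ν₁ = ν D d (suc j)
  ν₂ = ν D d (suc (suc j))
  R₀ = rowTail D r (suc (suc (suc j)))
  R₁ = rowTail D (suc r) (suc (suc j))
  C₀ = colTail D (suc (suc j)) (suc r)
  C₁ = colTail D (suc j) (suc (suc r))
  step₀ : ν₀ + R₁ ≡ ν₁ + C₁
  step₀ = ν-step D (trans d≡ (+-suc (suc r) j)) (s≤s z≤n) (subst (_≤ n) (+-suc r j) bound)
  step₁ : ν₁ + R₀ ≡ ν₂ + C₀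
  step₁ = ν-step D d≡ 1≤r bound

-- Condition (2) implies irreducibility

-- Throughout, d is written 2 + e, so that d ∸ 1 and d ∸ 2 compute to 1 + e and e.
module StandardFormFacts {n e a b : ℕ} (D : FerrersDiagram n) (e<a : suc e ≤ a) (e<b : suc e ≤ b)
                         (sf : StandardForm D (suc (suc e)) a b) where

  box-in : ∀ {x y} → suc e ≤ x → x ≤ a → suc e ≤ y → y ≤ b → mem D x y ≡ true
  box-in e<x x≤a e<y y≤b = proj₂ (Equivalence.from (sf _ _) ((e<x , x≤a) , (e<y , y≤b)))

  box-out : ∀ {x y} → mem D x y ≡ true → suc e ≤ x → suc e ≤ y → x ≤ a × y ≤ b
  box-out {x} {y} xy∈D e<x e<y =
    let ((_ , x≤a) , (_ , y≤b)) = Equivalence.to (sf x y) (((e<x , row≤n D xy∈D) , (e<y , col≤n D xy∈D)) , xy∈D)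
    in x≤a , y≤b

  rect : ∀ {x y} → 1 ≤ x → x ≤ a → 1 ≤ y → y ≤ b → mem D x y ≡ true
  rect = downClosed D a b _ _ (box-in e<a ≤-refl e<b ≤-refl)

cond2⇒irreducible : ∀ {n e} (D : FerrersDiagram n) → Cond2 D (suc (suc e)) → Irreducible D (suc (suc e))
cond2⇒irreducible {n} {e} D (a , b , e<a , e<b , sf , ν₀≡νlast , ν₀≤mid , central) (_ , D′ , arrow) =
  blocked arrow
  where
  open StandardFormFacts D e<a e<b sf
  d : ℕ
  d = suc (suc e)
  ν₀≤ : ∀ i → i ≤ suc e → ν D d 0 ≤ ν D d i
  ν₀≤ zero    _       = ≤-refl
  ν₀≤ (suc i) i<1+e with m≤n⇒m<n∨m≡n i<1+e
  ... | inj₁ i<e  = ν₀≤mid (suc i) (s≤s z≤n) (s≤s⁻¹ i<e)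
  ... | inj₂ refl = ≤-reflexive ν₀≡νlast
  ν₀-min : ν D d 0 ≡ νmin D d
  ν₀-min = ≤-antisym (minTo-glb (ν D d) (suc e) ν₀≤) (minTo-≤ (ν D d) {suc e} z≤n)
  νlast-min : ν D d (suc e) ≡ νmin D d
  νlast-min = trans (sym ν₀≡νlast) ν₀-min

  removal-hits-minimiser : ∀ p q → IsPointRemoval D′ D p q →
    ∃[ k ] k ≤ suc e × ν D d k ≡ νmin D d × quadrant d k p q ≡ true
  removal-hits-minimiser p q rem with d ≤? p | d ≤? q
  ... | yes d≤p | _ = 0 , z≤n , ν₀-min , quadrant-true d≤p (1≤col D (proj₁ rem))
  ... | no _ | yes d≤q =
    suc e , ≤-refl , νlast-min ,
    quadrant-true {d} {suc e} (subst (_≤ p) (sym (m+n∸n≡m 1 (suc e))) (1≤row D (proj₁ rem))) d≤q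
  ... | no d≰p | no d≰q =
    let (below , right) = PointRemoval.removed-cell-is-corner D′ D p q rem
        1≤p = 1≤row D (proj₁ rem)
        1≤q = 1≤col D (proj₁ rem)
        (e≡p , e≡q) = corner-maximal D below right (box-in ≤-refl e<a ≤-refl e<b) 1≤p 1≤q
                        (s≤s⁻¹ (≰⇒> d≰p)) (s≤s⁻¹ (≰⇒> d≰q))
        (a≡p , b≡q) = corner-maximal D below right (box-in e<a ≤-refl e<b ≤-refl) 1≤p 1≤q
                        (subst (_≤ a) e≡p e<a) (subst (_≤ b) e≡q e<b)
        (j , (1≤j , j≤e) , νj≡ν₀) = central (trans a≡p (sym e≡p)) (trans b≡q (sym e≡q))
    in j , m≤n⇒m≤1+n j≤e , trans νj≡ν₀ ν₀-min ,
       subst₂ (λ x y → quadrant d j x y ≡ true) e≡p e≡q (quadrant-true (∸-monoʳ-≤ d 1≤j) (s≤s j≤e))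

  addition-misses-minimiser : ∀ p q → IsPointRemoval D D′ p q →
    ∃[ k ] k ≤ suc e × ν D d k ≡ νmin D d × quadrant d k p q ≡ false
  addition-misses-minimiser p q rem with quadrant d 0 p q in Q₀ | quadrant d (suc e) p q in Qlast
  ... | false | _     = 0 , z≤n , ν₀-min , Q₀
  ... | true  | false = suc e , ≤-refl , νlast-min , Qlast
  ... | true  | true  = ⊥-elim (true≢false (trans (sym (box-in e<p p≤a e<q q≤b)) removed-cell-absent))
    where
    open PointRemoval D D′ p q rem
    d≤p : d ≤ p
    d≤p = proj₁ (quadrant-true⁻¹ d 0 p q Q₀)
    d≤q : d ≤ q
    d≤q = proj₂ (quadrant-true⁻¹ d (suc e) p q Qlast)
    e<p : suc e ≤ p
    e<p = <⇒≤ d≤p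
    e<q : suc e ≤ q
    e<q = <⇒≤ d≤q
    q≤b : q ≤ b
    q≤b = proj₂ (box-out (removal-below (s≤s z≤n) e<p (≤-trans (s≤s z≤n) e<q) ≤-refl
                                        (λ (e≡p , _) → <⇒≢ d≤p e≡p)) ≤-refl e<q)
    p≤a : p ≤ a
    p≤a = proj₁ (box-out (removal-below (≤-trans (s≤s z≤n) e<p) ≤-refl (s≤s z≤n) e<q
                                        (λ (_ , e≡q) → <⇒≢ d≤q e≡q)) e<p ≤-refl)

  blocked : Arrow D′ d D → ⊥
  blocked (inj₁ (p , q , rem , νmin≡)) =
    let (k , k≤ , νk≡ , inQ) = removal-hits-minimiser p q rem
    in <⇒≢ (PointRemoval.νmin-drops D′ D p q rem k≤ νk≡ inQ) νmin≡
  blocked (inj₂ (p , q , rem , νmin≢)) =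
    let (k , k≤ , νk≡ , outQ) = addition-misses-minimiser p q rem
    in νmin≢ (sym (PointRemoval.νmin-kept-by-addition D D′ p q rem k≤ νk≡ outQ))

-- Irreducibility implies condition (2)

module Irreducibility {n e : ℕ} (D : FerrersDiagram n) (irr : Irreducible D (suc (suc e)))
                      (centre∈D : mem D (suc e) (suc e) ≡ true) where

  d μ : ℕ
  d = suc (suc e)
  μ = νmin D d

  square∈D : ∀ {x y} → 1 ≤ x → x ≤ suc e → 1 ≤ y → y ≤ suc e → mem D x y ≡ true
  square∈D = downClosed D (suc e) (suc e) _ _ centre∈D

  μ≤ν : ∀ {i} → i ≤ suc e → μ ≤ ν D d i
  μ≤ν = minTo-≤ (ν D d)

  μ<ν : ∀ {i} → i ≤ suc e → ν D d i ≢ μ → μ < ν D d i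
  μ<ν i≤ νi≢μ = ≤∧≢⇒< (μ≤ν i≤) (≢-sym νi≢μ)

  d∸j≡ : ∀ {r j} → r + j ≡ suc e → d ∸ j ≡ suc r
  d∸j≡ {r} {j} r+j≡ = trans (cong (λ k → suc k ∸ j) (sym r+j≡)) (m+n∸n≡m (suc r) j)

  grow-row : ∀ {r j y} → 1 ≤ j → r + j ≡ suc e → mem D r y ≡ true → mem D (suc r) y ≡ false →
    (∀ i → i ≤ suc e → ν D d i ≡ μ → j ≤ i) → ⊥
  grow-row {r} {j} {y} 1≤j r+j≡ ry∈D r+1y∉D late =
    let (q , e≤q , r+1q∈D , r+1q+1∉D) = row-end D (square∈D (s≤s z≤n) r<e (s≤s z≤n) ≤-refl)
        q<y = row-gap D r+1q∈D r+1y∉D (1≤col D ry∈D)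
        above = downClosed D r y r (suc q) ry∈D (1≤row D ry∈D) ≤-refl (s≤s z≤n) q<y
    in irr (reducible-by-addition D r+1q+1∉D (inj₂ above) (inj₂ r+1q∈D) (λ i i≤ νi≡μ →
              quadrant-true (subst (d ∸ i ≤_) (d∸j≡ r+j≡) (∸-monoʳ-≤ d (late i i≤ νi≡μ)))
                            (s≤s (≤-trans i≤ e≤q))))
    where
    r<e : suc r ≤ suc e
    r<e = subst (suc r ≤_) r+j≡ (subst (_≤ r + j) (+-comm r 1) (+-monoʳ-≤ r 1≤j))

  grow-col : ∀ {x j} → j < suc e → mem D x j ≡ true → mem D x (suc j) ≡ false →
    (∀ i → i ≤ suc e → ν D d i ≡ μ → i ≤ j) → ⊥
  grow-col {x} {j} j<e xj∈D xj+1∉D early =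
    let (p , e≤p , pj+1∈D , p+1j+1∉D) = col-end D (square∈D (s≤s z≤n) ≤-refl (s≤s z≤n) j<e)
        p<x = col-gap D pj+1∈D xj+1∉D (1≤row D xj∈D)
        left = downClosed D x j (suc p) j xj∈D (s≤s z≤n) p<x (1≤col D xj∈D) ≤-refl
    in irr (reducible-by-addition D p+1j+1∉D (inj₂ pj+1∈D) (inj₂ left) (λ i i≤ νi≡μ →
              quadrant-true (≤-trans (m∸n≤m d i) (s≤s e≤p)) (s≤s (early i i≤ νi≡μ))))

  grow-first-row : (∀ i → i ≤ suc e → ν D d i ≡ μ → suc e ≤ i) → ⊥
  grow-first-row late =
    let (q , e≤q , 1q∈D , 1q+1∉D) = row-end D (square∈D ≤-refl (s≤s z≤n) (s≤s z≤n) ≤-refl)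
    in irr (reducible-by-addition D 1q+1∉D (inj₁ refl) (inj₂ 1q∈D) (λ i i≤ νi≡μ →
              quadrant-true (subst (d ∸ i ≤_) (m+n∸n≡m 1 (suc e)) (∸-monoʳ-≤ d (late i i≤ νi≡μ)))
                            (s≤s (≤-trans i≤ e≤q))))

  grow-first-col : (∀ i → i ≤ suc e → ν D d i ≡ μ → i ≡ 0) → ⊥
  grow-first-col early =
    let (p , e≤p , p1∈D , p+11∉D) = col-end D (square∈D (s≤s z≤n) ≤-refl ≤-refl (s≤s z≤n))
    in irr (reducible-by-addition D p+11∉D (inj₂ p1∈D) (inj₁ refl) (λ i i≤ νi≡μ →
              quadrant-true (≤-trans (m∸n≤m d i) (s≤s e≤p)) (s≤s (≤-reflexive (early i i≤ νi≡μ)))))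

  shrink-row : ∀ {r j y} → r + j ≡ suc e → mem D r y ≡ true → mem D (suc r) y ≡ false →
    (∀ {i} → j < i → i ≤ suc e → ν D d i ≢ μ) → ⊥
  shrink-row {r} {j} {y} r+j≡ ry∈D r+1y∉D after =
    let (q , y≤q , rq∈D , rq+1∉D) = row-end D ry∈D
        r+1q∉D = absent-beyond D r+1y∉D (s≤s z≤n) (1≤col D ry∈D) ≤-refl y≤q
    in irr (reducible-by-removal D rq∈D r+1q∉D rq+1∉D (λ i i≤ Qi →
              μ<ν i≤ (after (j<i (proj₁ (quadrant-true⁻¹ d i r q Qi))) i≤)))
    where
    j<i : ∀ {i} → d ∸ i ≤ r → j < i
    j<i {i} d∸i≤r = ≰⇒> (λ i≤j →
      1+n≰n (≤-trans (subst (_≤ d ∸ i) (d∸j≡ r+j≡) (∸-monoʳ-≤ d i≤j)) d∸i≤r))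

  shrink-col : ∀ {x j} → mem D x j ≡ true → mem D x (suc j) ≡ false →
    (∀ {i} → i < j → ν D d i ≢ μ) → ⊥
  shrink-col {x} {j} xj∈D xj+1∉D before =
    let (p , x≤p , pj∈D , p+1j∉D) = col-end D xj∈D
        pj+1∉D = absent-beyond D xj+1∉D (1≤row D xj∈D) (s≤s z≤n) x≤p ≤-refl
    in irr (reducible-by-removal D pj∈D p+1j∉D pj+1∉D (λ i i≤ Qi →
              μ<ν i≤ (before (proj₂ (quadrant-true⁻¹ d i p j Qi)))))

  minimiser-spreads : ∀ {r j} → 1 ≤ r → r + suc j ≡ suc e → RowWithin D r → ColWithin D (suc j) →
    ν D d (suc j) ≡ μ → ν D d j ≡ μ × ν D d (suc (suc j)) ≡ μ
  minimiser-spreads {r} {j} 1≤r r+j+1≡ rows cols ν₁≡μ =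
    ≤-antisym (subst (ν₀ ≤_) ν₁≡μ ν₀≤ν₁) (μ≤ν j≤e) ,
    ≤-antisym (subst (ν₂ ≤_) ν₁≡μ ν₂≤ν₁) (μ≤ν j+2≤e)
    where
    ν₀ ν₁ ν₂ : ℕ
    ν₀ = ν D d j
    ν₁ = ν D d (suc j)
    ν₂ = ν D d (suc (suc j))
    j+2≤e : suc (suc j) ≤ suc e
    j+2≤e = subst (suc (suc j) ≤_) r+j+1≡ (+-monoˡ-≤ (suc j) 1≤r)
    j≤e : j ≤ suc e
    j≤e = ≤-trans (n≤1+n j) (≤-trans (n≤1+n (suc j)) j+2≤e)
    concave : ν₀ + ν₂ ≤ ν₁ + ν₁
    concave = ν-concave D (cong suc (sym r+j+1≡)) 1≤r (subst (_≤ n) (sym r+j+1≡) (row≤n D centre∈D))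
                        rows cols
    ν₁≤ν₀ : ν₁ ≤ ν₀
    ν₁≤ν₀ = subst (_≤ ν₀) (sym ν₁≡μ) (μ≤ν j≤e)
    ν₁≤ν₂ : ν₁ ≤ ν₂
    ν₁≤ν₂ = subst (_≤ ν₂) (sym ν₁≡μ) (μ≤ν j+2≤e)
    ν₀≤ν₁ : ν₀ ≤ ν₁
    ν₀≤ν₁ = +-cancelʳ-≤ ν₂ ν₀ ν₁ (≤-trans concave (+-monoʳ-≤ ν₁ ν₁≤ν₂))
    ν₂≤ν₁ : ν₂ ≤ ν₁
    ν₂≤ν₁ = +-cancelˡ-≤ ν₀ ν₂ ν₁ (≤-trans concave (+-monoˡ-≤ ν₁ ν₁≤ν₀))

  paired-row : ∀ {j} → suc j < suc e → e ∸ j + suc j ≡ suc e × 1 ≤ e ∸ j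
  paired-row {j} (s≤s j<e) = trans (+-suc (e ∸ j) j) (cong suc (m∸n+n≡m (<⇒≤ j<e))) , m<n⇒0<n∸m j<e

  first-minimiser-not-positive : ∀ {j} → suc j ≤ suc e → ν D d (suc j) ≡ μ →
    (∀ {i} → i < suc j → ν D d i ≢ μ) → ⊥
  first-minimiser-not-positive {j} j<e ν₁≡μ before with m≤n⇒m<n∨m≡n j<e
  ... | inj₂ refl = grow-first-row late
    where
    late : ∀ i → i ≤ suc e → ν D d i ≡ μ → suc j ≤ i
    late i _ νi≡μ = ≮⇒≥ (λ i<j+1 → before i<j+1 νi≡μ)
  ... | inj₁ j+1<e with paired-row j+1<e | row-within? D (e ∸ j) | col-within? D (suc j)
  ...   | r+j+1≡ , _ | inj₁ (_ , ry∈D , r+1y∉D) | _ =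
    grow-row (s≤s z≤n) r+j+1≡ ry∈D r+1y∉D (λ i _ νi≡μ → ≮⇒≥ (λ i<j+1 → before i<j+1 νi≡μ))
  ...   | _ , _ | inj₂ _ | inj₁ (_ , xj∈D , xj+1∉D) = shrink-col xj∈D xj+1∉D before
  ...   | r+j+1≡ , 1≤r | inj₂ rows | inj₂ cols =
    before ≤-refl (proj₁ (minimiser-spreads 1≤r r+j+1≡ rows cols ν₁≡μ))

  last-minimiser-not-before-last : ∀ {j} → j < suc e → ν D d j ≡ μ →
    (∀ {i} → j < i → i ≤ suc e → ν D d i ≢ μ) → ⊥
  last-minimiser-not-before-last {zero} _ _ after =
    grow-first-col (λ i i≤ νi≡μ → n≤0⇒n≡0 (≮⇒≥ (λ 0<i → after 0<i i≤ νi≡μ)))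
  last-minimiser-not-before-last {suc j} j+1<e ν₁≡μ after
    with paired-row j+1<e | row-within? D (e ∸ j) | col-within? D (suc j)
  ... | r+j+1≡ , _ | inj₁ (_ , ry∈D , r+1y∉D) | _ = shrink-row r+j+1≡ ry∈D r+1y∉D after
  ... | _ , _ | inj₂ _ | inj₁ (_ , xj∈D , xj+1∉D) =
    grow-col j+1<e xj∈D xj+1∉D (λ i i≤ νi≡μ → ≮⇒≥ (λ j+1<i → after j+1<i i≤ νi≡μ))
  ... | r+j+1≡ , 1≤r | inj₂ rows | inj₂ cols =
    after ≤-refl j+1<e (proj₂ (minimiser-spreads 1≤r r+j+1≡ rows cols ν₁≡μ))

  ν₀-minimal : ν D d 0 ≡ μ
  ν₀-minimal with minTo-attained (ν D d) (suc e)
  ... | k , k≤e , νk≡μ with least (λ i → ν D d i ≟ μ) νk≡μ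
  ...   | zero  , _   , ν₀≡μ   , _      = ν₀≡μ
  ...   | suc j , j<k , νj+1≡μ , before =
    ⊥-elim (first-minimiser-not-positive (≤-trans j<k k≤e) νj+1≡μ before)

  νlast-minimal : ν D d (suc e) ≡ μ
  νlast-minimal with minTo-attained (ν D d) (suc e)
  ... | k , k≤e , νk≡μ with greatest (λ i → ν D d i ≟ μ) k≤e νk≡μ
  ...   | j , _ , j≤e , νj≡μ , after with m≤n⇒m<n∨m≡n j≤e
  ...     | inj₂ refl = νj≡μ
  ...     | inj₁ j<e  = ⊥-elim (last-minimiser-not-before-last j<e νj≡μ after)

  central-minimiser : mem D (suc (suc e)) (suc e) ≡ false → mem D (suc e) (suc (suc e)) ≡ false →
    ∃[ j ] (1 ≤ j × j ≤ e) × ν D d j ≡ ν D d 0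
  central-minimiser below right with anyUpTo? (λ j → ν D d (suc j) ≟ ν D d 0) e
  ... | yes (j , j<e , νj+1≡ν₀) = suc j , (s≤s z≤n , j<e) , νj+1≡ν₀
  ... | no none = ⊥-elim (irr (reducible-by-removal D centre∈D below right blocked))
    where
    blocked : ∀ i → i ≤ suc e → quadrant d i (suc e) (suc e) ≡ true → μ < ν D d i
    blocked zero    _  Q₀ = ⊥-elim (1+n≰n (proj₁ (quadrant-true⁻¹ d 0 (suc e) (suc e) Q₀)))
    blocked (suc i) i≤ Qi = μ<ν i≤ (λ νi+1≡μ →
      none (i , s≤s⁻¹ (proj₂ (quadrant-true⁻¹ d (suc i) (suc e) (suc e) Qi)) ,
            trans νi+1≡μ (sym ν₀-minimal)))

  rectangle-corner : ∀ {a b} → suc e ≤ a → suc e ≤ b → mem D a (suc e) ≡ true → mem D (suc e) b ≡ true →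
    mem D a b ≡ true
  rectangle-corner {a} {b} e≤a e≤b ae∈D eb∈D = ¬-not λ ab∉D →
    let (p , e≤p , pb∈D , p+1b∉D) = col-end D eb∈D
        p<a = col-gap D pb∈D ab∉D (1≤row D ae∈D)
        p+1e∈D = downClosed D a (suc e) (suc p) (suc e) ae∈D (s≤s z≤n) p<a (s≤s z≤n) ≤-refl
        (q , e≤q , p+1q∈D , p+1q+1∉D) = row-end D p+1e∈D
        q<b = row-gap D p+1q∈D p+1b∉D (1≤col D eb∈D)
        above = downClosed D p b p (suc q) pb∈D (1≤row D pb∈D) ≤-refl (s≤s z≤n) q<b
    in irr (reducible-by-addition D p+1q+1∉D (inj₂ above) (inj₂ p+1q∈D) (λ i i≤ _ →
              quadrant-true (≤-trans (m∸n≤m d i) (s≤s e≤p)) (s≤s (≤-trans i≤ e≤q))))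

  standard-form : ∀ {a b} → suc e ≤ a → suc e ≤ b →
    mem D a (suc e) ≡ true → mem D (suc a) (suc e) ≡ false →
    mem D (suc e) b ≡ true → mem D (suc e) (suc b) ≡ false → StandardForm D d a b
  standard-form {a} {b} e≤a e≤b ae∈D a+1e∉D eb∈D eb+1∉D x y = mk⇔ in-box in-D
    where
    ab∈D : mem D a b ≡ true
    ab∈D = rectangle-corner e≤a e≤b ae∈D eb∈D
    in-box : ((suc e ≤ x × x ≤ n) × (suc e ≤ y × y ≤ n)) × mem D x y ≡ true →
      (suc e ≤ x × x ≤ a) × (suc e ≤ y × y ≤ b)
    in-box (((e≤x , _) , (e≤y , _)) , xy∈D) =
      (e≤x , s≤s⁻¹ (col-gap D xe∈D a+1e∉D (s≤s z≤n))) ,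
      (e≤y , s≤s⁻¹ (row-gap D ey∈D eb+1∉D (s≤s z≤n)))
      where
      xe∈D : mem D x (suc e) ≡ true
      xe∈D = downClosed D x y x (suc e) xy∈D (1≤row D xy∈D) ≤-refl (s≤s z≤n) e≤y
      ey∈D : mem D (suc e) y ≡ true
      ey∈D = downClosed D x y (suc e) y xy∈D (s≤s z≤n) e≤x (1≤col D xy∈D) ≤-refl
    in-D : (suc e ≤ x × x ≤ a) × (suc e ≤ y × y ≤ b) →
      ((suc e ≤ x × x ≤ n) × (suc e ≤ y × y ≤ n)) × mem D x y ≡ true
    in-D ((e≤x , x≤a) , (e≤y , y≤b)) =
      ((e≤x , ≤-trans x≤a (row≤n D ab∈D)) , (e≤y , ≤-trans y≤b (col≤n D ab∈D))) ,
      downClosed D a b x y ab∈D (≤-trans (s≤s z≤n) e≤x) x≤a (≤-trans (s≤s z≤n) e≤y) y≤b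

meetsB⇒centre : ∀ {n e} (D : FerrersDiagram n) → MeetsB D (suc (suc e)) → mem D (suc e) (suc e) ≡ true
meetsB⇒centre {e = e} D (x , y , (e≤x , _) , (e≤y , _) , xy∈D) =
  downClosed D x y (suc e) (suc e) xy∈D (s≤s z≤n) e≤x (s≤s z≤n) e≤y

irreducible⇒cond2 : ∀ {n e} (D : FerrersDiagram n) → MeetsB D (suc (suc e)) →
  Irreducible D (suc (suc e)) → Cond2 D (suc (suc e))
irreducible⇒cond2 {n} {e} D meets irr
  with col-end D (meetsB⇒centre D meets) | row-end D (meetsB⇒centre D meets)
... | a , e≤a , ae∈D , a+1e∉D | b , e≤b , eb∈D , eb+1∉D =
  a , b , e≤a , e≤b , standard-form e≤a e≤b ae∈D a+1e∉D eb∈D eb+1∉D ,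
  trans ν₀-minimal (sym νlast-minimal) ,
  (λ j _ j≤e → subst (_≤ ν D d j) (sym ν₀-minimal) (μ≤ν (m≤n⇒m≤1+n j≤e))) ,
  (λ a≡e b≡e → central-minimiser (subst (λ a → mem D (suc a) (suc e) ≡ false) a≡e a+1e∉D)
                                 (subst (λ b → mem D (suc e) (suc b) ≡ false) b≡e eb+1∉D))
  where open Irreducibility D irr (meetsB⇒centre D meets)

reducible-at-1 : ∀ {n} (D : FerrersDiagram n) → MeetsB D 1 → Reducible D 1
reducible-at-1 D (x , y , _ , _ , xy∈D) =
  let 11∈D = downClosed D x y 1 1 xy∈D ≤-refl (1≤row D xy∈D) ≤-refl (1≤col D xy∈D)
      (q , _ , 1q∈D , 1q+1∉D) = row-end D 11∈D
  in reducible-by-addition {d = 1} D 1q+1∉D (inj₁ refl) (inj₂ 1q∈D) (λ { zero _ _ → refl ; (suc _) () _ })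

no-standardForm-at-1 : ∀ {n a b} (D : FerrersDiagram n) → StandardForm D 1 a b → ⊥
no-standardForm-at-1 D sf =
  <-irrefl refl (1≤row D (proj₂ (Equivalence.from (sf 0 0) ((z≤n , z≤n) , (z≤n , z≤n)))))

irreducible⇔cond2 : ∀ {n d} (D : FerrersDiagram n) → 1 ≤ d → MeetsB D d → Irreducible D d ⇔ Cond2 D d
irreducible⇔cond2 {d = suc zero} D _ meets =
  mk⇔ (λ irr → ⊥-elim (irr (reducible-at-1 D meets)))
      (λ (_ , _ , _ , _ , sf , _) → ⊥-elim (no-standardForm-at-1 D sf))
irreducible⇔cond2 {d = suc (suc e)} D _ meets = mk⇔ (irreducible⇒cond2 D meets) (cond2⇒irreducible D)

-- Conditions (2) and (3)

sumTo-shift : ∀ N (f : ℕ → ℕ) → sumTo (suc N) f ≡ f 1 + sumTo N (λ i → f (suc i))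
sumTo-shift zero    f = sym (+-identityʳ (f 1))
sumTo-shift (suc N) f = trans (cong (_+ f (suc (suc N))) (sumTo-shift N f)) (+-assoc (f 1) _ _)

sumTo-reverse : ∀ N (f : ℕ → ℕ) → sumTo N (λ i → f (suc N ∸ i)) ≡ sumTo N f
sumTo-reverse zero    f = refl
sumTo-reverse (suc N) f = begin
    sumTo N (λ i → f (suc (suc N) ∸ i)) + f (suc (suc N) ∸ suc N)
  ≡⟨ cong₂ _+_ (sumTo-cong N (λ i _ i≤N → cong f (+-∸-assoc 1 (m≤n⇒m≤1+n i≤N))))
               (cong f (m+n∸n≡m 1 (suc N))) ⟩
    sumTo N (λ i → f (suc (suc N ∸ i))) + f 1
  ≡⟨ cong (_+ f 1) (sumTo-reverse N (λ i → f (suc i))) ⟩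
    sumTo N (λ i → f (suc i)) + f 1
  ≡⟨ +-comm _ (f 1) ⟩
    f 1 + sumTo N (λ i → f (suc i))
  ≡⟨ sym (sumTo-shift N f) ⟩
    sumTo (suc N) f
  ∎
  where open ≡-Reasoning

sumToℤ-pos : ∀ N (f : ℕ → ℕ) → sumToℤ N (λ i → + f i) ≡ + sumTo N f
sumToℤ-pos zero    f = refl
sumToℤ-pos (suc N) f = cong (ℤ._+ + f (suc N)) (sumToℤ-pos N f)

pos-∸ : ∀ {m k} → k ≤ m → + (m ∸ k) ≡ + m ℤ.- + k
pos-∸ {m} {k} k≤m = sym (trans (ℤP.m-n≡m⊖n m k) (ℤP.⊖-≥ k≤m))

rowTail-split : ∀ {n} (D : FerrersDiagram n) {r b k} → (∀ {y} → 1 ≤ y → y ≤ b → mem D r y ≡ true) →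
  1 ≤ k → k ≤ suc b → b ≤ n → rowTail D r k ≡ (suc b ∸ k) + rowTail D r (suc b)
rowTail-split {n} D {r} {b} {k} full 1≤k k≤b+1 b≤n =
  trans (count-split n split) (cong (_+ rowTail D r (suc b)) (count-interval n 1≤k k≤b+1 b≤n))
  where
  split : ∀ y → 1 ≤ y → y ≤ n →
    𝟙 (mem D r y ∧ (k ≤ᵇ y)) ≡ 𝟙 ((k ≤ᵇ y) ∧ (y ≤ᵇ b)) + 𝟙 (mem D r y ∧ (suc b ≤ᵇ y))
  split y 1≤y _ with y ≤? b
  ... | yes y≤b
    rewrite full 1≤y y≤b | ≤ᵇ-true y≤b | ≤ᵇ-false {suc b} (s≤s y≤b) | ∧-identityʳ (k ≤ᵇ y) = sym (+-identityʳ _)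
  ... | no y≰b
    rewrite ≤ᵇ-true (≤-trans k≤b+1 (≰⇒> y≰b)) | ≤ᵇ-false (≰⇒> y≰b) | ≤ᵇ-true {suc b} (≰⇒> y≰b) = refl

module νProfile {n e a b : ℕ} (D : FerrersDiagram n) (e<a : suc e ≤ a) (e<b : suc e ≤ b)
               (sf : StandardForm D (suc (suc e)) a b) where

  open StandardFormFacts D e<a e<b sf

  d : ℕ
  d = suc (suc e)

  X Y : ℕ → ℕ → Bool
  X = Xmem D d b
  Y = Ymem D d a

  a≤n : a ≤ n
  a≤n = row≤n D (box-in e<a ≤-refl e<b ≤-refl)

  b≤n : b ≤ n
  b≤n = col≤n D (box-in e<a ≤-refl e<b ≤-refl)

  cX≡rowTail : ∀ {r} → 1 ≤ r → r ≤ suc e → c n X r ≡ rowTail D r (suc b)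
  cX≡rowTail {r} 1≤r r≤e+1 = sumTo-cong n (λ y _ _ → cong 𝟙 (pointwise y))
    where
    pointwise : ∀ y → X y r ≡ (mem D r y ∧ (suc b ≤ᵇ y))
    pointwise y with r ≤? e
    ... | yes r≤e rewrite ≤ᵇ-true 1≤r | ≤ᵇ-true r≤e = refl
    ... | no r≰e
      rewrite ≤-antisym r≤e+1 (≰⇒> r≰e) | ≤ᵇ-false {suc e} {e} ≤-refl | ∧-zeroʳ (mem D (suc e) y) =
      sym (¬-not λ ry∈tail →
        let (ry∈D , b<y) = ∧-true⁻¹ ry∈tail
            b<y′ = ≤ᵇ-true⁻¹ {suc b} b<y
        in <⇒≱ b<y′ (proj₂ (box-out ry∈D ≤-refl (≤-trans e<b (<⇒≤ b<y′)))))

  cY≡colTail : ∀ {j} → 1 ≤ j → j ≤ suc e → c n Y j ≡ colTail D j (suc a)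
  cY≡colTail {j} 1≤j j≤e+1 = sumTo-cong n (λ x _ _ → cong 𝟙 (pointwise x))
    where
    pointwise : ∀ x → Y x j ≡ (mem D x j ∧ (suc a ≤ᵇ x))
    pointwise x with j ≤? e
    ... | yes j≤e rewrite ≤ᵇ-true 1≤j | ≤ᵇ-true j≤e = cong (mem D x j ∧_) (∧-identityʳ _)
    ... | no j≰e rewrite ≤-antisym j≤e+1 (≰⇒> j≰e) | ≤ᵇ-false {suc e} {e} ≤-refl
                       | ∧-zeroʳ (suc a ≤ᵇ x) | ∧-zeroʳ (mem D x (suc e)) =
      sym (¬-not λ xj∈tail →
        let (xj∈D , a<x) = ∧-true⁻¹ xj∈tail
            a<x′ = ≤ᵇ-true⁻¹ {suc a} a<x
        in <⇒≱ a<x′ (proj₁ (box-out xj∈D (≤-trans e<a (<⇒≤ a<x′)) ≤-refl)))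

  K : ℤ
  K = + b ℤ.- + a ℤ.+ + suc e

  Δ : ℕ → ℤ
  Δ j = (K ℤ.- + 2 ℤ.* + j ℤ.- + 1) ℤ.+ + c n X (d ∸ suc j) ℤ.- + c n Y (suc j)

  ν-increment : ∀ {j} → j ≤ e → + ν D d (suc j) ≡ + ν D d j ℤ.+ Δ j
  ν-increment {j} j≤e = begin
      + ν D d (suc j)
    ≡⟨ cancel (+ ν D d (suc j)) (+ CT) ⟩
      + (ν D d (suc j) + CT) ℤ.- + CT
    ≡⟨ cong (λ m → + m ℤ.- + CT) (sym (ν-step D d≡ 1≤r r+j≤n)) ⟩
      + ν D d j ℤ.+ + RT ℤ.- + CT
    ≡⟨ cong₂ (λ u v → + ν D d j ℤ.+ u ℤ.- v) RT≡ CT≡ ⟩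
      + ν D d j ℤ.+ ((+ b ℤ.- + suc j) ℤ.+ + c n X r) ℤ.- ((+ a ℤ.- (+ suc e ℤ.- + j)) ℤ.+ + c n Y (suc j))
    ≡⟨ rearrange (+ ν D d j) (+ b) (+ a) (+ suc e) (+ j) (+ c n X r) (+ c n Y (suc j)) ⟩
      + ν D d j ℤ.+ Δ j
    ∎
    where
    open ≡-Reasoning
    cancel : ∀ (x y : ℤ) → x ≡ (x ℤ.+ y) ℤ.- y
    cancel = solve-∀
    rearrange : ∀ (V B A S J x y : ℤ) →
      V ℤ.+ ((B ℤ.- (+ 1 ℤ.+ J)) ℤ.+ x) ℤ.- ((A ℤ.- (S ℤ.- J)) ℤ.+ y) ≡
      V ℤ.+ (((B ℤ.- A ℤ.+ S) ℤ.- + 2 ℤ.* J ℤ.- + 1) ℤ.+ x ℤ.- y)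
    rearrange = solve-∀
    r RT CT : ℕ
    r = suc e ∸ j
    RT = rowTail D r (suc (suc j))
    CT = colTail D (suc j) (suc r)
    r+j≡ : r + j ≡ suc e
    r+j≡ = m∸n+n≡m (m≤n⇒m≤1+n j≤e)
    d≡ : d ≡ suc r + j
    d≡ = cong suc (sym r+j≡)
    1≤r : 1 ≤ r
    1≤r = m<n⇒0<n∸m (s≤s j≤e)
    r≤e+1 : r ≤ suc e
    r≤e+1 = m∸n≤m (suc e) j
    r+j≤n : r + j ≤ n
    r+j≤n = subst (_≤ n) (sym r+j≡) (≤-trans e<a a≤n)
    j+1≤b : suc j ≤ b
    j+1≤b = ≤-trans (s≤s j≤e) e<b
    RT≡ : + RT ≡ (+ b ℤ.- + suc j) ℤ.+ + c n X r
    RT≡ = begin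
        + RT
      ≡⟨ cong +_ (rowTail-split D (rect 1≤r (≤-trans r≤e+1 e<a)) (s≤s z≤n) (s≤s j+1≤b) b≤n) ⟩
        + (b ∸ suc j) ℤ.+ + rowTail D r (suc b)
      ≡⟨ cong₂ ℤ._+_ (pos-∸ j+1≤b) (cong +_ (sym (cX≡rowTail 1≤r r≤e+1))) ⟩
        (+ b ℤ.- + suc j) ℤ.+ + c n X r
      ∎
    CT≡ : + CT ≡ (+ a ℤ.- (+ suc e ℤ.- + j)) ℤ.+ + c n Y (suc j)
    CT≡ = begin
        + CT
      ≡⟨ cong +_ (rowTail-split (transpose D) (λ 1≤x x≤a → rect 1≤x x≤a (s≤s z≤n) j+1≤b)
                                (s≤s z≤n) (s≤s (≤-trans r≤e+1 e<a)) a≤n) ⟩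
        + (a ∸ r) ℤ.+ + colTail D (suc j) (suc a)
      ≡⟨ cong₂ ℤ._+_ (trans (pos-∸ (≤-trans r≤e+1 e<a))
                            (cong (λ m → + a ℤ.- m) (pos-∸ (m≤n⇒m≤1+n j≤e))))
                     (cong +_ (sym (cY≡colTail (s≤s z≤n) (s≤s j≤e)))) ⟩
        (+ a ℤ.- (+ suc e ℤ.- + j)) ℤ.+ + c n Y (suc j)
      ∎

  Φ-step : ∀ j → Φ D d a b (suc j) ≡ Φ D d a b j ℤ.+ Δ j
  Φ-step j = step (+ j) K (sumToℤ j (λ i → + c n X (d ∸ i))) (sumToℤ j (λ i → + c n Y i))
                  (+ c n X (d ∸ suc j)) (+ c n Y (suc j))
    where
    step : ∀ (J K SX SY x y : ℤ) →
      (+ 1 ℤ.+ J) ℤ.* (K ℤ.- (+ 1 ℤ.+ J)) ℤ.+ (SX ℤ.+ x) ℤ.- (SY ℤ.+ y) ≡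
      (J ℤ.* (K ℤ.- J) ℤ.+ SX ℤ.- SY) ℤ.+ ((K ℤ.- + 2 ℤ.* J ℤ.- + 1) ℤ.+ x ℤ.- y)
    step = solve-∀

  ν-via-Φ : ∀ {j} → j ≤ suc e → + ν D d j ≡ + ν D d 0 ℤ.+ Φ D d a b j
  ν-via-Φ {zero}  _ = sym (ℤP.+-identityʳ _)
  ν-via-Φ {suc j} j<e = begin
      + ν D d (suc j)                          ≡⟨ ν-increment (s≤s⁻¹ j<e) ⟩
      + ν D d j ℤ.+ Δ j                        ≡⟨ cong (ℤ._+ Δ j) (ν-via-Φ (<⇒≤ j<e)) ⟩
      (+ ν D d 0 ℤ.+ Φ D d a b j) ℤ.+ Δ j      ≡⟨ ℤP.+-assoc (+ ν D d 0) (Φ D d a b j) (Δ j) ⟩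
      + ν D d 0 ℤ.+ (Φ D d a b j ℤ.+ Δ j)      ≡⟨ cong (λ m → + ν D d 0 ℤ.+ m) (sym (Φ-step j)) ⟩
      + ν D d 0 ℤ.+ Φ D d a b (suc j)          ∎
    where open ≡-Reasoning

  cX-beyond : ∀ {q} → e < q → c n X q ≡ 0
  cX-beyond {q} e<q = sumTo-zero n (λ p _ _ → cong 𝟙 (vanish p))
    where
    vanish : ∀ p → X p q ≡ false
    vanish p rewrite ≤ᵇ-false e<q | ∧-zeroʳ (1 ≤ᵇ q) = ∧-zeroʳ (mem D q p)

  cY-beyond : ∀ {q} → e < q → c n Y q ≡ 0
  cY-beyond {q} e<q = sumTo-zero n (λ p _ _ → cong 𝟙 (vanish p))
    where
    vanish : ∀ p → Y p q ≡ false
    vanish p rewrite ≤ᵇ-false e<q | ∧-zeroʳ (1 ≤ᵇ q) | ∧-zeroʳ (suc a ≤ᵇ p) = ∧-zeroʳ (mem D p q)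

  column-sum : ∀ (Z : ℕ → ℕ → Bool) → (∀ {q} → e < q → c n Z q ≡ 0) →
    sumTo (suc e) (c n Z) ≡ card2 n Z
  column-sum Z beyond =
    sym (trans (card2-transpose n Z) (sumTo-truncate (≤-trans e<a a≤n) (λ q e+1<q _ → beyond (<⇒≤ e+1<q))))

  Φ-last : Φ D d a b (suc e) ≡ (+ b ℤ.- + a) ℤ.* + suc e ℤ.- (+ card2 n Y ℤ.- + card2 n X)
  Φ-last = trans (cong₂ (λ u v → + suc e ℤ.* (K ℤ.- + suc e) ℤ.+ u ℤ.- v) ΣX≡ ΣY≡)
                 (rearrange (+ suc e) (+ b) (+ a) (+ card2 n X) (+ card2 n Y))
    where
    rearrange : ∀ (S B A x y : ℤ) →
      S ℤ.* ((B ℤ.- A ℤ.+ S) ℤ.- S) ℤ.+ x ℤ.- y ≡ (B ℤ.- A) ℤ.* S ℤ.- (y ℤ.- x)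
    rearrange = solve-∀
    ΣX≡ : sumToℤ (suc e) (λ i → + c n X (d ∸ i)) ≡ + card2 n X
    ΣX≡ = trans (sumToℤ-pos (suc e) (λ i → c n X (d ∸ i)))
                (cong +_ (trans (sumTo-reverse (suc e) (c n X)) (column-sum X cX-beyond)))
    ΣY≡ : sumToℤ (suc e) (λ i → + c n Y i) ≡ + card2 n Y
    ΣY≡ = trans (sumToℤ-pos (suc e) (c n Y)) (cong +_ (column-sum Y cY-beyond))

  Φ≡ν-ν₀ : ∀ {j} → j ≤ suc e → Φ D d a b j ≡ + ν D d j ℤ.- + ν D d 0
  Φ≡ν-ν₀ {j} j≤ = trans (cancel (+ ν D d 0) (Φ D d a b j)) (cong (ℤ._- + ν D d 0) (sym (ν-via-Φ j≤)))
    where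
    cancel : ∀ (x y : ℤ) → y ≡ (x ℤ.+ y) ℤ.- x
    cancel = solve-∀

  0≤Φ⇔ : ∀ {j} → j ≤ suc e → (+ 0 ℤ.≤ Φ D d a b j) ⇔ (ν D d 0 ≤ ν D d j)
  0≤Φ⇔ j≤ rewrite Φ≡ν-ν₀ j≤ =
    mk⇔ (λ 0≤Φ → ℤP.drop‿+≤+ (ℤP.0≤i-j⇒j≤i 0≤Φ)) (λ ν₀≤νj → ℤP.i≤j⇒0≤j-i (+≤+ ν₀≤νj))

  Φ≡0⇔ : ∀ {j} → j ≤ suc e → (Φ D d a b j ≡ + 0) ⇔ (ν D d j ≡ ν D d 0)
  Φ≡0⇔ j≤ rewrite Φ≡ν-ν₀ j≤ =
    mk⇔ (λ Φ≡0 → ℤP.+-injective (ℤP.i-j≡0⇒i≡j _ _ Φ≡0)) (λ νj≡ν₀ → ℤP.i≡j⇒i-j≡0 (cong +_ νj≡ν₀))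

  balance⇔ : (ν D d 0 ≡ ν D d (suc e)) ⇔ (+ card2 n Y ℤ.- + card2 n X ≡ (+ b ℤ.- + a) ℤ.* + suc e)
  balance⇔ = mk⇔
    (λ ν₀≡νlast →
      sym (ℤP.i-j≡0⇒i≡j _ _ (trans (sym Φ-last) (Equivalence.from (Φ≡0⇔ ≤-refl) (sym ν₀≡νlast)))))
    (λ Y-X≡ → sym (Equivalence.to (Φ≡0⇔ ≤-refl) (trans Φ-last (ℤP.i≡j⇒i-j≡0 (sym Y-X≡)))))

cond2⇔cond3 : ∀ {n d} (D : FerrersDiagram n) → 1 ≤ d → Cond2 D d ⇔ Cond3 D d
cond2⇔cond3 {d = suc zero} D _ =
  mk⇔ (λ (_ , _ , _ , _ , sf , _) → ⊥-elim (no-standardForm-at-1 D sf))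
      (λ (_ , _ , _ , _ , sf , _) → ⊥-elim (no-standardForm-at-1 D sf))
cond2⇔cond3 {d = suc (suc e)} D _ = mk⇔ 2⇒3 3⇒2
  where
  2⇒3 : Cond2 D (suc (suc e)) → Cond3 D (suc (suc e))
  2⇒3 (a , b , e<a , e<b , sf , ν₀≡νlast , ν₀≤ , central) =
    a , b , e<a , e<b , sf , Equivalence.to balance⇔ ν₀≡νlast ,
    (λ j 1≤j j≤e → Equivalence.from (0≤Φ⇔ (m≤n⇒m≤1+n j≤e)) (ν₀≤ j 1≤j j≤e)) ,
    (λ a≡e b≡e → let (j , (1≤j , j≤e) , νj≡ν₀) = central a≡e b≡e
                 in j , (1≤j , j≤e) , Equivalence.from (Φ≡0⇔ (m≤n⇒m≤1+n j≤e)) νj≡ν₀)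
    where open νProfile D e<a e<b sf
  3⇒2 : Cond3 D (suc (suc e)) → Cond2 D (suc (suc e))
  3⇒2 (a , b , e<a , e<b , sf , Y-X≡ , 0≤Φ , central) =
    a , b , e<a , e<b , sf , Equivalence.from balance⇔ Y-X≡ ,
    (λ j 1≤j j≤e → Equivalence.to (0≤Φ⇔ (m≤n⇒m≤1+n j≤e)) (0≤Φ j 1≤j j≤e)) ,
    (λ a≡e b≡e → let (j , (1≤j , j≤e) , Φj≡0) = central a≡e b≡e
                 in j , (1≤j , j≤e) , Equivalence.to (Φ≡0⇔ (m≤n⇒m≤1+n j≤e)) Φj≡0)
    where open νProfile D e<a e<b sf

theorem4p10 : (n d : ℕ) → 1 ≤ d → (D : FerrersDiagram n) → MeetsB D d →
    (Irreducible D d ⇔ Cond2 D d) × (Irreducible D d ⇔ Cond3 D d)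
theorem4p10 n d 1≤d D meets =
  irreducible⇔cond2 D 1≤d meets , ⇔-trans (irreducible⇔cond2 D 1≤d meets) (cond2⇔cond3 D 1≤d)
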